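{- For every nonnegative integer $N$, let \[ f_N(q) := \sum_{j\geq 0} q^{3j^2 -2j} {N \brack 3j}_q (q^2;q^3)_j. \] Then \[ f_{N+1}(q) = F_N(0,1,1;1) - q^N F_{N-1}(0,1,1;1). \]
   Context: Gaussian binomial: ${A\brack B}_q=0$ if $B>A$ or $B<0$, otherwise $\frac{(q;q)_A}{(q;q)_B(q;q)_{A-B}}$, with $(a;q)_n=\prod_{t=0}^{n-1}(1-aq^t)$. For integers $N$, $F_N(0,1,1;x)=0$ if $N<0$, and for $N\ge0$ \[ F_N(0,1,1;x)=\sum_{m,n\ge0}(-1)^n q^{\binom{3n+1}{2}+m^2+3mn}x^{m+3n}{N-3n-m+1\brack m}_q{N-2n-m\brack n}_{q^3}; \] $F_N(0,1,1;1)$ is its value at $x=1$. -}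

module Defs where

open import Data.Nat as ℕ using (ℕ; zero; suc)
open import Data.Nat.Combinatorics using (_C_)
open import Data.Integer as ℤ using (ℤ; +_; -[1+_])
open import Data.Rational as ℚ using (ℚ; 0ℚ; 1ℚ; _+_; _*_; _-_; -_; _÷_; ≢-nonZero)
open import Data.Rational.Properties using (_≟_)
open import Data.List using (List; upTo; foldr; map)
open import Relation.Nullary using (yes; no)

pow : ℚ → ℕ → ℚ
pow q zero    = 1ℚ
pow q (suc n) = pow q n * q

nℚ : ℕ → ℚ
nℚ n = + n ℚ./ 1

-- division, total: returns 0 when the divisor is 0 (never used in that case
-- under the hypotheses of the theorem, where all denominators are nonzero)
_⊘_ : ℚ → ℚ → ℚ
a ⊘ b with b ≟ 0ℚ
... | yes _ = 0ℚ
... | no b≢0 = _÷_ a b {{≢-nonZero b≢0}}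

poch : ℚ → ℚ → ℕ → ℚ
poch a q zero    = 1ℚ
poch a q (suc n) = poch a q n * (1ℚ - a * pow q n)

gbinℕ : ℚ → ℕ → ℕ → ℚ
gbinℕ q A B with B ℕ.≤? A
... | yes _ = poch q q A ⊘ (poch q q B * poch q q (A ℕ.∸ B))
... | no _  = 0ℚ

gbin : ℚ → ℤ → ℤ → ℚ
gbin q (+ A)    (+ B)    = gbinℕ q A B
gbin q -[1+ _ ] _        = 0ℚ   -- A < 0 ≤ B or B < 0: in all cases B > A or B < 0
gbin q (+ A)    -[1+ _ ] = 0ℚ

sumTo : ℕ → (ℕ → ℚ) → ℚ
sumTo n f = foldr _+_ 0ℚ (map f (upTo n))

-- f_N(q) = Σ_{j≥0} q^{3j²-2j} [N choose 3j]_q (q²;q³)_j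
-- (terms with 3j > N vanish, so j ranges over 0..N; 3j²-2j ≥ 0 for j ∈ ℕ)
fN : ℕ → ℚ → ℚ
fN N q = sumTo (suc N) λ j →
  pow q (3 ℕ.* j ℕ.* j ℕ.∸ 2 ℕ.* j) * gbin q (+ N) (+ (3 ℕ.* j)) * poch (pow q 2) (pow q 3) j

-- F_N(0,1,1;x) for integer N: 0 if N < 0, otherwise
-- Σ_{m,n≥0} (-1)^n q^{C(3n+1,2)+m²+3mn} x^{m+3n} [N-3n-m+1 choose m]_q [N-2n-m choose n]_{q³}
-- Nonzero terms need 0 ≤ m ≤ N-3n-m+1, hence m ≤ N+1 and 3n ≤ N+1,
-- so m, n range over 0..N+1.
F011 : ℤ → ℚ → ℚ → ℚ
F011 -[1+ _ ] q x = 0ℚ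
F011 (+ N)    q x =
  sumTo (suc (suc N)) λ m → sumTo (suc (suc N)) λ n →
    pow (- 1ℚ) n
    * pow q ((3 ℕ.* n ℕ.+ 1) C 2 ℕ.+ m ℕ.* m ℕ.+ 3 ℕ.* m ℕ.* n)
    * pow x (m ℕ.+ 3 ℕ.* n)
    * gbin q (+ N ℤ.- + (3 ℕ.* n) ℤ.- + m ℤ.+ + 1) (+ m)
    * gbin (pow q 3) (+ N ℤ.- + (2 ℕ.* n) ℤ.- + m) (+ n)

-- Let E_M(x) = (−x;q)_M / (−x³;q³)_M = 1 / ∏_{t<M} (1 − qᵗ x + q²ᵗ x²).  Expanding this quotient
-- as a double series shows F_N(0,1,1;1) = g_(N+1), where g_(K+1) = Σ_{M+s=K} q^binom(s+1,2) [xˢ] E_(M+1),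
-- and E_M = (1 − q^M x + q^(2M) x²) E_(M+1) gives g_(K+2) = (1 + q^(K+1)) g_(K+1) − q^(2K+1) g_K.
-- On the other side f_N = Λ[(−x;q)_N] for the functional Λ[A] = Σ_j c_j [x^3j] A, where
-- c_j = q^(3j²−2j−binom(3j,2)) (q²;q³)_j satisfies c_(j+1) = c_j (q^(−3j−2) − 1).  This q-difference
-- equation and the two q-Pascal rules give a first-order system in N for Λ[(−x;q)_N], Λ[x (−x;q)_N]
-- and Λ[x² (−x;q)_N], and an induction on N matches it with the recursion of g.

module Submission where

open import Defs
open import Data.Empty using (⊥; ⊥-elim)
open import Data.Integer as ℤ using (_⊖_)
import Data.Integer.Properties as ℤ
open import Data.Integer.Tactic.RingSolver renaming (solve-∀ to ℤ-solve-∀)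
open import Data.List using (foldr; map; applyUpTo)
open import Data.Nat as ℕ using (ℕ; zero; suc; z≤n; s≤s; _∸_)
open import Data.Nat.Combinatorics using (_C_; nC1≡n; nCk+nC[k+1]≡[n+1]C[k+1])
import Data.Nat.Properties as ℕ
open import Data.Nat.Tactic.RingSolver renaming (solve-∀ to ℕ-solve-∀)
open import Data.Product using (_×_; _,_; proj₁; proj₂)
open import Data.Rational as ℚ using (ℚ; 0ℚ; 1ℚ; _+_; _*_; _-_; -_; 1/_; ∣_∣; _≤_; ≢-nonZero)
import Data.Rational.Properties as ℚ
open import Data.Sum using (inj₁; inj₂)
open import Function using (_∘_; id)
open import Level using (0ℓ)
open import Relation.Binary.Definitions using (Tri; tri<; tri≈; tri>)
open import Relation.Binary.PropositionalEquality
open import Relation.Nullary using (yes; no)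
open import Relation.Nullary.Decidable using (dec⇒maybe)
open import Tactic.RingSolver using (solve-∀)
open import Tactic.RingSolver.Core.AlmostCommutativeRing using (AlmostCommutativeRing; fromCommutativeRing)
open ≡-Reasoning

ℚ-ring : AlmostCommutativeRing 0ℓ 0ℓ
ℚ-ring = fromCommutativeRing ℚ.+-*-commutativeRing (λ x → dec⇒maybe (0ℚ ℚ.≟ x))

cong₃ : ∀ {A B C D : Set} (f : A → B → C → D) {x y u v w z} → x ≡ y → u ≡ v → w ≡ z → f x u w ≡ f y v z
cong₃ f refl refl refl = refl

*-zeroʳ-both : ∀ w a c → w * (a * 0ℚ) ≡ c * 0ℚ
*-zeroʳ-both = solve-∀ ℚ-ring

+-interchange : ∀ a b c d → (a + b) + (c + d) ≡ (a + c) + (b + d)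
+-interchange = solve-∀ ℚ-ring

∑ : ℕ → (ℕ → ℚ) → ℚ
∑ zero    f = 0ℚ
∑ (suc n) f = f 0 + ∑ n (f ∘ suc)

sumTo≡∑ : ∀ n f → sumTo n f ≡ ∑ n f
sumTo≡∑ n f = go n id
  where
  go : ∀ n g → foldr _+_ 0ℚ (map f (applyUpTo g n)) ≡ ∑ n (f ∘ g)
  go zero    g = refl
  go (suc n) g = cong (f (g 0) +_) (go n (g ∘ suc))

∑-cong : ∀ n {f g : ℕ → ℚ} → (∀ i → f i ≡ g i) → ∑ n f ≡ ∑ n g
∑-cong zero    f≡g = refl
∑-cong (suc n) f≡g = cong₂ _+_ (f≡g 0) (∑-cong n (f≡g ∘ suc))

∑-zero : ∀ n {f : ℕ → ℚ} → (∀ i → f i ≡ 0ℚ) → ∑ n f ≡ 0ℚ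
∑-zero zero    f≡0 = refl
∑-zero (suc n) f≡0 = cong₂ _+_ (f≡0 0) (∑-zero n (f≡0 ∘ suc))

∑-+ : ∀ n (f g : ℕ → ℚ) → ∑ n (λ i → f i + g i) ≡ ∑ n f + ∑ n g
∑-+ zero    f g = refl
∑-+ (suc n) f g = begin
  (f 0 + g 0) + ∑ n (λ i → f (suc i) + g (suc i))     ≡⟨ cong ((f 0 + g 0) +_) (∑-+ n (f ∘ suc) (g ∘ suc)) ⟩
  (f 0 + g 0) + (∑ n (f ∘ suc) + ∑ n (g ∘ suc))       ≡⟨ +-interchange (f 0) (g 0) _ _ ⟩
  (f 0 + ∑ n (f ∘ suc)) + (g 0 + ∑ n (g ∘ suc))       ∎

∑-*ˡ : ∀ n c (f : ℕ → ℚ) → ∑ n (λ i → c * f i) ≡ c * ∑ n f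
∑-*ˡ zero    c f = sym (ℚ.*-zeroʳ c)
∑-*ˡ (suc n) c f = trans (cong (c * f 0 +_) (∑-*ˡ n c (f ∘ suc)))
                         (sym (ℚ.*-distribˡ-+ c (f 0) (∑ n (f ∘ suc))))

∑-sucʳ : ∀ n (f : ℕ → ℚ) → ∑ (suc n) f ≡ ∑ n f + f n
∑-sucʳ zero    f = ℚ.+-comm (f 0) 0ℚ
∑-sucʳ (suc n) f = trans (cong (f 0 +_) (∑-sucʳ n (f ∘ suc)))
                         (sym (ℚ.+-assoc (f 0) (∑ n (f ∘ suc)) (f (suc n))))

∑-vanishing-tail : ∀ n k (f : ℕ → ℚ) → (∀ i → n ℕ.≤ i → f i ≡ 0ℚ) → ∑ (n ℕ.+ k) f ≡ ∑ n f
∑-vanishing-tail zero    k f f≡0 = ∑-zero k (λ i → f≡0 i z≤n)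
∑-vanishing-tail (suc n) k f f≡0 =
  cong (f 0 +_) (∑-vanishing-tail n k (f ∘ suc) (λ i n≤i → f≡0 (suc i) (s≤s n≤i)))

pow-+ : ∀ q m n → pow q (m ℕ.+ n) ≡ pow q m * pow q n
pow-+ q zero    n = sym (ℚ.*-identityˡ (pow q n))
pow-+ q (suc m) n = begin
  pow q (m ℕ.+ n) * q        ≡⟨ cong (_* q) (pow-+ q m n) ⟩
  pow q m * pow q n * q      ≡⟨ swap (pow q m) (pow q n) q ⟩
  pow q m * q * pow q n      ∎
  where
  swap : ∀ a b c → a * b * c ≡ a * c * b
  swap = solve-∀ ℚ-ring

pow-+-≡ : ∀ q {a b c} → a ℕ.+ b ≡ c → pow q a * pow q b ≡ pow q c
pow-+-≡ q {a} {b} a+b≡c = trans (sym (pow-+ q a b)) (cong (pow q) a+b≡c)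

pow-* : ∀ a b n → pow (a * b) n ≡ pow a n * pow b n
pow-* a b zero    = refl
pow-* a b (suc n) = trans (cong (_* (a * b)) (pow-* a b n)) (regroup (pow a n) (pow b n) a b)
  where
  regroup : ∀ x y a b → x * y * (a * b) ≡ x * a * (y * b)
  regroup = solve-∀ ℚ-ring

pow-1ℚ : ∀ n → pow 1ℚ n ≡ 1ℚ
pow-1ℚ zero    = refl
pow-1ℚ (suc n) = cong (_* 1ℚ) (pow-1ℚ n)

pow-pow : ∀ q a b → pow (pow q a) b ≡ pow q (a ℕ.* b)
pow-pow q a zero    = cong (pow q) (sym (ℕ.*-zeroʳ a))
pow-pow q a (suc b) = begin
  pow (pow q a) b * pow q a   ≡⟨ cong (_* pow q a) (pow-pow q a b) ⟩
  pow q (a ℕ.* b) * pow q a   ≡⟨ sym (pow-+ q (a ℕ.* b) a) ⟩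
  pow q (a ℕ.* b ℕ.+ a)       ≡⟨ cong (pow q) (trans (ℕ.+-comm (a ℕ.* b) a) (sym (ℕ.*-suc a b))) ⟩
  pow q (a ℕ.* suc b)         ∎

pow-cube : ∀ q M → pow (pow q 3) M ≡ pow q M * pow q M * pow q M
pow-cube q M = begin
  pow (pow q 3) M                       ≡⟨ pow-pow q 3 M ⟩
  pow q (3 ℕ.* M)                       ≡⟨ cong (pow q) (ℕ.*-comm 3 M) ⟩
  pow q (M ℕ.* 3)                       ≡⟨ sym (pow-pow q M 3) ⟩
  1ℚ * pow q M * pow q M * pow q M      ≡⟨ cong (λ x → x * pow q M * pow q M) (ℚ.*-identityˡ (pow q M)) ⟩
  pow q M * pow q M * pow q M           ∎

pow-inverse : ∀ {q r} → q * r ≡ 1ℚ → ∀ n → pow q n * pow r n ≡ 1ℚ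
pow-inverse {q} {r} qr≡1 n = trans (sym (pow-* q r n)) (trans (cong (λ x → pow x n) qr≡1) (pow-1ℚ n))

NotRootOfUnity : ℚ → Set
NotRootOfUnity q = ∀ t → pow q (suc t) ≢ 1ℚ

module _ (a : ℚ) .{{_ : ℚ.NonNegative a}} where

  pow-≤-1 : a ≤ 1ℚ → ∀ t → pow a (suc t) ≤ a
  pow-≤-1 a≤1 zero    = ℚ.≤-reflexive (ℚ.*-identityˡ a)
  pow-≤-1 a≤1 (suc t) = ℚ.≤-trans (ℚ.*-monoʳ-≤-nonNeg a (ℚ.≤-trans (pow-≤-1 a≤1 t) a≤1))
                                  (ℚ.≤-reflexive (ℚ.*-identityˡ a))

  pow-≥-1 : 1ℚ ≤ a → ∀ t → a ≤ pow a (suc t)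
  pow-≥-1 1≤a zero    = ℚ.≤-reflexive (sym (ℚ.*-identityˡ a))
  pow-≥-1 1≤a (suc t) = ℚ.≤-trans (ℚ.≤-reflexive (sym (ℚ.*-identityˡ a)))
                                  (ℚ.*-monoʳ-≤-nonNeg a (ℚ.≤-trans 1≤a (pow-≥-1 1≤a t)))

pow-∣∣ : ∀ q n → ∣ pow q n ∣ ≡ pow ∣ q ∣ n
pow-∣∣ q zero    = refl
pow-∣∣ q (suc n) = trans (ℚ.∣p*q∣≡∣p∣*∣q∣ (pow q n) q) (cong (_* ∣ q ∣) (pow-∣∣ q n))

-- A power of |q| ≠ 1 stays strictly on the same side of 1.
notRootOfUnity : ∀ {q} → q ≢ 1ℚ → q ≢ - 1ℚ → NotRootOfUnity q
notRootOfUnity {q} q≢1 q≢-1 t qᵗ⁺¹≡1 = compare (ℚ.<-cmp ∣ q ∣ 1ℚ)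
  where
  instance
    ∣q∣-nonNeg : ℚ.NonNegative ∣ q ∣
    ∣q∣-nonNeg = ℚ.∣-∣-nonNeg q
  ∣q∣ᵗ⁺¹≡1 : pow ∣ q ∣ (suc t) ≡ 1ℚ
  ∣q∣ᵗ⁺¹≡1 = trans (sym (pow-∣∣ q (suc t))) (cong ∣_∣ qᵗ⁺¹≡1)
  compare : Tri (∣ q ∣ ℚ.< 1ℚ) (∣ q ∣ ≡ 1ℚ) (1ℚ ℚ.< ∣ q ∣) → ⊥
  compare (tri< ∣q∣<1 _ _) = ℚ.<-irrefl ∣q∣ᵗ⁺¹≡1 (ℚ.≤-<-trans (pow-≤-1 ∣ q ∣ (ℚ.<⇒≤ ∣q∣<1) t) ∣q∣<1)
  compare (tri> _ _ ∣q∣>1) = ℚ.<-irrefl (sym ∣q∣ᵗ⁺¹≡1) (ℚ.<-≤-trans ∣q∣>1 (pow-≥-1 ∣ q ∣ (ℚ.<⇒≤ ∣q∣>1) t))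
  compare (tri≈ _ ∣q∣≡1 _) with ℚ.∣p∣≡p∨∣p∣≡-p q
  ... | inj₁ ∣q∣≡q  = q≢1 (trans (sym ∣q∣≡q) ∣q∣≡1)
  ... | inj₂ ∣q∣≡-q = q≢-1 (ℚ.neg-injective (trans (sym ∣q∣≡-q) ∣q∣≡1))

notRootOfUnity-pow : ∀ {q} k → NotRootOfUnity q → NotRootOfUnity (pow q (suc k))
notRootOfUnity-pow {q} k q↯ t eq = q↯ (k ℕ.+ suc k ℕ.* t) (begin
  pow q (suc (k ℕ.+ suc k ℕ.* t))   ≡⟨ cong (pow q) (sym (ℕ.*-suc (suc k) t)) ⟩
  pow q (suc k ℕ.* suc t)           ≡⟨ sym (pow-pow q (suc k) (suc t)) ⟩
  pow (pow q (suc k)) (suc t)       ≡⟨ eq ⟩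
  1ℚ                                ∎)

qbinom : ℚ → ℕ → ℕ → ℚ
qbinom q n       zero    = 1ℚ
qbinom q zero    (suc k) = 0ℚ
qbinom q (suc n) (suc k) = pow q (suc k) * qbinom q n (suc k) + qbinom q n k

qbinom-vanish : ∀ q {n k} → n ℕ.< k → qbinom q n k ≡ 0ℚ
qbinom-vanish q {zero}  {suc k} _         = refl
qbinom-vanish q {suc n} {suc k} (s≤s n<k) = begin
  pow q (suc k) * qbinom q n (suc k) + qbinom q n k
    ≡⟨ cong₂ (λ a b → pow q (suc k) * a + b) (qbinom-vanish q (ℕ.m<n⇒m<1+n n<k)) (qbinom-vanish q n<k) ⟩
  pow q (suc k) * 0ℚ + 0ℚ
    ≡⟨ trans (ℚ.+-identityʳ _) (ℚ.*-zeroʳ (pow q (suc k))) ⟩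
  0ℚ ∎

qbinom-diag : ∀ q n → qbinom q n n ≡ 1ℚ
qbinom-diag q zero    = refl
qbinom-diag q (suc n) = begin
  pow q (suc n) * qbinom q n (suc n) + qbinom q n n
    ≡⟨ cong₂ (λ a b → pow q (suc n) * a + b) (qbinom-vanish q (ℕ.n<1+n n)) (qbinom-diag q n) ⟩
  pow q (suc n) * 0ℚ + 1ℚ
    ≡⟨ cong (_+ 1ℚ) (ℚ.*-zeroʳ (pow q (suc n))) ⟩
  1ℚ ∎

-- [n+1, k+1] = [n, k+1] + q^(n−k) [n, k], written with n = k + d.
qbinom-pascal′ : ∀ q k d → qbinom q (suc (k ℕ.+ d)) (suc k) ≡ qbinom q (k ℕ.+ d) (suc k) + pow q d * qbinom q (k ℕ.+ d) k
qbinom-pascal′ q k zero rewrite ℕ.+-identityʳ k = begin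
  qbinom q (suc k) (suc k)                          ≡⟨ qbinom-diag q (suc k) ⟩
  1ℚ                                                ≡⟨ sym (cong₂ (λ a b → a + 1ℚ * b) (qbinom-vanish q (ℕ.n<1+n k)) (qbinom-diag q k)) ⟩
  qbinom q k (suc k) + 1ℚ * qbinom q k k            ∎
qbinom-pascal′ q zero (suc d) = begin
  pow q 1 * qbinom q (suc d) 1 + 1ℚ                  ≡⟨ cong (λ x → pow q 1 * x + 1ℚ) (qbinom-pascal′ q zero d) ⟩
  pow q 1 * (qbinom q d 1 + pow q d * 1ℚ) + 1ℚ       ≡⟨ expand q (qbinom q d 1) (pow q d) ⟩
  (pow q 1 * qbinom q d 1 + 1ℚ) + pow q d * q * 1ℚ   ∎
  where
  expand : ∀ q b p → (1ℚ * q) * (b + p * 1ℚ) + 1ℚ ≡ ((1ℚ * q) * b + 1ℚ) + p * q * 1ℚ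
  expand = solve-∀ ℚ-ring
qbinom-pascal′ q (suc k) (suc d) rewrite ℕ.+-suc k d = begin
  pow q (2 ℕ.+ k) * B n+1 (2 ℕ.+ k) + B n+1 (suc k)
    ≡⟨ cong₂ (λ a b → pow q (2 ℕ.+ k) * a + b) (qbinom-pascal′ q (suc k) d) inner ⟩
  pow q (2 ℕ.+ k) * (B n (2 ℕ.+ k) + pow q d * B n (suc k)) + (B n (suc k) + pow q (suc d) * B n k)
    ≡⟨ regroup (pow q k) q (pow q d) (B n (2 ℕ.+ k)) (B n (suc k)) (B n k) ⟩
  (pow q (2 ℕ.+ k) * B n (2 ℕ.+ k) + B n (suc k)) + pow q (suc d) * (pow q (suc k) * B n (suc k) + B n k) ∎
  where
  B   = qbinom q
  n   = suc (k ℕ.+ d)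
  n+1 = suc n
  inner : B n+1 (suc k) ≡ B n (suc k) + pow q (suc d) * B n k
  inner = subst (λ m → B (suc m) (suc k) ≡ B m (suc k) + pow q (suc d) * B m k) (ℕ.+-suc k d) (qbinom-pascal′ q k (suc d))
  regroup : ∀ a q p x y z → (a * q * q) * (x + p * y) + (y + p * q * z) ≡ ((a * q * q) * x + y) + p * q * ((a * q) * y + z)
  regroup = solve-∀ ℚ-ring

qbinom-poch : ∀ q k d → qbinom q (k ℕ.+ d) k * (poch q q k * poch q q d) ≡ poch q q (k ℕ.+ d)
qbinom-poch q zero    d = trans (ℚ.*-identityˡ _) (ℚ.*-identityˡ (poch q q d))
qbinom-poch q (suc k) zero rewrite ℕ.+-identityʳ k = begin
  qbinom q (suc k) (suc k) * (poch q q (suc k) * 1ℚ)   ≡⟨ cong₂ _*_ (qbinom-diag q (suc k)) (ℚ.*-identityʳ (poch q q (suc k))) ⟩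
  1ℚ * poch q q (suc k)                                 ≡⟨ ℚ.*-identityˡ _ ⟩
  poch q q (suc k)                                      ∎
qbinom-poch q (suc k) (suc d) rewrite ℕ.+-suc k d = begin
  (pow q (suc k) * B n (suc k) + B n k) * (P (suc k) * P (suc d))
    ≡⟨ split q (pow q k) (pow q d) (B n (suc k)) (B n k) (P k) (P d) ⟩
  (q * pow q k) * (1ℚ - q * pow q d) * (B n (suc k) * (P (suc k) * P d)) + (1ℚ - q * pow q k) * (B n k * (P k * P (suc d)))
    ≡⟨ cong₂ (λ a b → (q * pow q k) * (1ℚ - q * pow q d) * a + (1ℚ - q * pow q k) * b) (qbinom-poch q (suc k) d) shifted ⟩
  (q * pow q k) * (1ℚ - q * pow q d) * P n + (1ℚ - q * pow q k) * P n
    ≡⟨ merge q (pow q k) (pow q d) (P n) ⟩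
  P n * (1ℚ - q * (pow q k * q * pow q d))
    ≡⟨ cong (λ x → P n * (1ℚ - q * x)) (sym (pow-+ q (suc k) d)) ⟩
  P (suc n) ∎
  where
  B = qbinom q
  P = poch q q
  n = suc (k ℕ.+ d)
  shifted : B n k * (P k * P (suc d)) ≡ P n
  shifted = subst (λ m → B m k * (P k * P (suc d)) ≡ P m) (ℕ.+-suc k d) (qbinom-poch q k (suc d))
  split : ∀ q a b x y p r →
    ((a * q) * x + y) * ((p * (1ℚ - q * a)) * (r * (1ℚ - q * b)))
    ≡ (q * a) * (1ℚ - q * b) * (x * ((p * (1ℚ - q * a)) * r)) + (1ℚ - q * a) * (y * (p * (r * (1ℚ - q * b))))
  split = solve-∀ ℚ-ring
  merge : ∀ q a b p → (q * a) * (1ℚ - q * b) * p + (1ℚ - q * a) * p ≡ p * (1ℚ - q * (a * q * b))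
  merge = solve-∀ ℚ-ring

*-≢0 : ∀ {x y} → x ≢ 0ℚ → y ≢ 0ℚ → x * y ≢ 0ℚ
*-≢0 {x} {y} x≢0 y≢0 xy≡0 = y≢0 (begin
  y                  ≡⟨ sym (ℚ.*-identityˡ y) ⟩
  1ℚ * y             ≡⟨ cong (_* y) (sym (ℚ.*-inverseˡ x)) ⟩
  (1/ x) * x * y     ≡⟨ ℚ.*-assoc (1/ x) x y ⟩
  (1/ x) * (x * y)   ≡⟨ cong ((1/ x) *_) xy≡0 ⟩
  (1/ x) * 0ℚ        ≡⟨ ℚ.*-zeroʳ (1/ x) ⟩
  0ℚ                 ∎)
  where
  instance
    x-nonZero : ℚ.NonZero x
    x-nonZero = ≢-nonZero x≢0

poch-≢0 : ∀ {q} → NotRootOfUnity q → ∀ n → poch q q n ≢ 0ℚ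
poch-≢0 q↯ zero    ()
poch-≢0 {q} q↯ (suc n) = *-≢0 (poch-≢0 q↯ n) factor≢0
  where
  factor≢0 : 1ℚ - q * pow q n ≢ 0ℚ
  factor≢0 eq = q↯ n (begin
    pow q n * q                ≡⟨ ℚ.*-comm (pow q n) q ⟩
    q * pow q n                ≡⟨ 1-[1-a] (q * pow q n) ⟩
    1ℚ - (1ℚ - q * pow q n)    ≡⟨ cong (_-_ 1ℚ) eq ⟩
    1ℚ - 0ℚ                    ∎)
    where
    1-[1-a] : ∀ a → a ≡ 1ℚ - (1ℚ - a)
    1-[1-a] = solve-∀ ℚ-ring

⊘-cancelʳ : ∀ b {y} → y ≢ 0ℚ → (b * y) ⊘ y ≡ b
⊘-cancelʳ b {y} y≢0 with y ℚ.≟ 0ℚ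
... | yes y≡0 = ⊥-elim (y≢0 y≡0)
... | no  y≢0′ = begin
  (b * y) * (1/ y)   ≡⟨ ℚ.*-assoc b y (1/ y) ⟩
  b * (y * (1/ y))   ≡⟨ cong (b *_) (ℚ.*-inverseʳ y) ⟩
  b * 1ℚ             ≡⟨ ℚ.*-identityʳ b ⟩
  b                  ∎
  where
  instance
    y-nonZero : ℚ.NonZero y
    y-nonZero = ≢-nonZero y≢0′

gbinℕ≡qbinom : ∀ {q} → NotRootOfUnity q → ∀ A B → gbinℕ q A B ≡ qbinom q A B
gbinℕ≡qbinom {q} q↯ A B with B ℕ.≤? A
... | no  B≰A = sym (qbinom-vanish q (ℕ.≰⇒> B≰A))
... | yes B≤A = begin
  P A ⊘ (P B * P (A ∸ B))
    ≡⟨ cong (λ m → P m ⊘ (P B * P (A ∸ B))) (sym A≡B+[A∸B]) ⟩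
  P (B ℕ.+ (A ∸ B)) ⊘ (P B * P (A ∸ B))
    ≡⟨ cong (_⊘ (P B * P (A ∸ B))) (sym (qbinom-poch q B (A ∸ B))) ⟩
  (qbinom q (B ℕ.+ (A ∸ B)) B * (P B * P (A ∸ B))) ⊘ (P B * P (A ∸ B))
    ≡⟨ ⊘-cancelʳ _ (*-≢0 (poch-≢0 q↯ B) (poch-≢0 q↯ (A ∸ B))) ⟩
  qbinom q (B ℕ.+ (A ∸ B)) B
    ≡⟨ cong (λ m → qbinom q m B) A≡B+[A∸B] ⟩
  qbinom q A B ∎
  where
  P = poch q q
  A≡B+[A∸B] : B ℕ.+ (A ∸ B) ≡ A
  A≡B+[A∸B] = ℕ.m+[n∸m]≡n B≤A

-- ∑₃ t s = Σ_{m + 3n = s} t m n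
∑₃ : (ℕ → ℕ → ℚ) → ℕ → ℚ
∑₃ t 0                       = t 0 0
∑₃ t 1                       = t 1 0
∑₃ t 2                       = t 2 0
∑₃ t (suc (suc (suc s)))     = t (3 ℕ.+ s) 0 + ∑₃ (λ m n → t m (suc n)) s

m+3[1+n]≡3+[m+3n] : ∀ m n → m ℕ.+ 3 ℕ.* suc n ≡ 3 ℕ.+ (m ℕ.+ 3 ℕ.* n)
m+3[1+n]≡3+[m+3n] = ℕ-solve-∀

∑₃-cong-on : ∀ s {t u : ℕ → ℕ → ℚ} → (∀ m n → m ℕ.+ 3 ℕ.* n ≡ s → t m n ≡ u m n) → ∑₃ t s ≡ ∑₃ u s
∑₃-cong-on 0 t≡u = t≡u 0 0 refl
∑₃-cong-on 1 t≡u = t≡u 1 0 refl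
∑₃-cong-on 2 t≡u = t≡u 2 0 refl
∑₃-cong-on (suc (suc (suc s))) t≡u =
  cong₂ _+_ (t≡u (3 ℕ.+ s) 0 (ℕ.+-identityʳ _))
            (∑₃-cong-on s (λ m n eq → t≡u m (suc n) (trans (m+3[1+n]≡3+[m+3n] m n) (cong (3 ℕ.+_) eq))))

∑₃-cong : ∀ s {t u : ℕ → ℕ → ℚ} → (∀ m n → t m n ≡ u m n) → ∑₃ t s ≡ ∑₃ u s
∑₃-cong s t≡u = ∑₃-cong-on s (λ m n _ → t≡u m n)

∑₃-+ : ∀ s (t u : ℕ → ℕ → ℚ) → ∑₃ (λ m n → t m n + u m n) s ≡ ∑₃ t s + ∑₃ u s
∑₃-+ 0 t u = refl
∑₃-+ 1 t u = refl
∑₃-+ 2 t u = refl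
∑₃-+ (suc (suc (suc s))) t u = begin
  (t (3 ℕ.+ s) 0 + u (3 ℕ.+ s) 0) + ∑₃ (λ m n → t m (suc n) + u m (suc n)) s
    ≡⟨ cong ((t (3 ℕ.+ s) 0 + u (3 ℕ.+ s) 0) +_) (∑₃-+ s _ _) ⟩
  (t (3 ℕ.+ s) 0 + u (3 ℕ.+ s) 0) + (∑₃ (λ m n → t m (suc n)) s + ∑₃ (λ m n → u m (suc n)) s)
    ≡⟨ +-interchange (t (3 ℕ.+ s) 0) (u (3 ℕ.+ s) 0) _ _ ⟩
  (t (3 ℕ.+ s) 0 + ∑₃ (λ m n → t m (suc n)) s) + (u (3 ℕ.+ s) 0 + ∑₃ (λ m n → u m (suc n)) s) ∎

∑₃-*ˡ : ∀ s c (t : ℕ → ℕ → ℚ) → ∑₃ (λ m n → c * t m n) s ≡ c * ∑₃ t s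
∑₃-*ˡ 0 c t = refl
∑₃-*ˡ 1 c t = refl
∑₃-*ˡ 2 c t = refl
∑₃-*ˡ (suc (suc (suc s))) c t =
  trans (cong (c * t (3 ℕ.+ s) 0 +_) (∑₃-*ˡ s c _)) (sym (ℚ.*-distribˡ-+ c _ _))

∑₃-zero : ∀ s {t : ℕ → ℕ → ℚ} → (∀ m n → m ℕ.+ 3 ℕ.* n ≡ s → t m n ≡ 0ℚ) → ∑₃ t s ≡ 0ℚ
∑₃-zero s t≡0 = trans (∑₃-cong-on s t≡0) (lemma s)
  where
  lemma : ∀ s → ∑₃ (λ _ _ → 0ℚ) s ≡ 0ℚ
  lemma 0                   = refl
  lemma 1                   = refl
  lemma 2                   = refl
  lemma (suc (suc (suc s))) = trans (ℚ.+-identityˡ _) (lemma s)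

shift : (ℕ → ℚ) → ℕ → ℚ
shift X zero    = 0ℚ
shift X (suc i) = X i

shift-cong : ∀ {X Y : ℕ → ℚ} → (∀ i → X i ≡ Y i) → ∀ i → shift X i ≡ shift Y i
shift-cong X≡Y zero    = refl
shift-cong X≡Y (suc i) = X≡Y i

shift-vanish : ∀ {K} (X : ℕ → ℚ) → (∀ {i} → K ℕ.< i → X i ≡ 0ℚ) → ∀ {i} → suc K ℕ.< i → shift X i ≡ 0ℚ
shift-vanish X X≡0 {suc i} (s≤s K<i) = X≡0 K<i

shift-+-* : ∀ (X Y : ℕ → ℚ) c i → shift (λ j → X j + c * Y j) i ≡ shift X i + c * shift Y i
shift-+-* X Y c zero    = sym (trans (ℚ.+-identityˡ _) (ℚ.*-zeroʳ c))
shift-+-* X Y c (suc i) = refl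

∑₃-split : ∀ t s → ∑₃ t s ≡ t s 0 + shift (shift (shift (∑₃ (λ m n → t m (suc n))))) s
∑₃-split t 0                   = sym (ℚ.+-identityʳ _)
∑₃-split t 1                   = sym (ℚ.+-identityʳ _)
∑₃-split t 2                   = sym (ℚ.+-identityʳ _)
∑₃-split t (suc (suc (suc s))) = refl

-- conv X Y s is the coefficient of xˢ in X(x) Y(x³).
conv : (ℕ → ℚ) → (ℕ → ℚ) → ℕ → ℚ
conv X Y = ∑₃ (λ m n → X m * Y n)

conv-+-*ˡ : ∀ (X X′ Y : ℕ → ℚ) c s → conv (λ m → X m + c * X′ m) Y s ≡ conv X Y s + c * conv X′ Y s
conv-+-*ˡ X X′ Y c s = begin
  ∑₃ (λ m n → (X m + c * X′ m) * Y n) s              ≡⟨ ∑₃-cong s (λ m n → distrib (X m) (X′ m) (Y n) c) ⟩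
  ∑₃ (λ m n → X m * Y n + c * (X′ m * Y n)) s        ≡⟨ ∑₃-+ s _ _ ⟩
  conv X Y s + ∑₃ (λ m n → c * (X′ m * Y n)) s       ≡⟨ cong (conv X Y s +_) (∑₃-*ˡ s c _) ⟩
  conv X Y s + c * conv X′ Y s                       ∎
  where
  distrib : ∀ x x′ y c → (x + c * x′) * y ≡ x * y + c * (x′ * y)
  distrib = solve-∀ ℚ-ring

conv-+-*ʳ : ∀ (X Y Y′ : ℕ → ℚ) c s → conv X (λ n → Y n + c * Y′ n) s ≡ conv X Y s + c * conv X Y′ s
conv-+-*ʳ X Y Y′ c s = begin
  ∑₃ (λ m n → X m * (Y n + c * Y′ n)) s              ≡⟨ ∑₃-cong s (λ m n → distrib (X m) (Y n) (Y′ n) c) ⟩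
  ∑₃ (λ m n → X m * Y n + c * (X m * Y′ n)) s        ≡⟨ ∑₃-+ s _ _ ⟩
  conv X Y s + ∑₃ (λ m n → c * (X m * Y′ n)) s       ≡⟨ cong (conv X Y s +_) (∑₃-*ˡ s c _) ⟩
  conv X Y s + c * conv X Y′ s                       ∎
  where
  distrib : ∀ x y y′ c → x * (y + c * y′) ≡ x * y + c * (x * y′)
  distrib = solve-∀ ℚ-ring

conv-shiftˡ : ∀ X Y s → conv (shift X) Y s ≡ shift (conv X Y) s
conv-shiftˡ X Y 0                         = ℚ.*-zeroˡ (Y 0)
conv-shiftˡ X Y 1                         = refl
conv-shiftˡ X Y 2                         = refl
conv-shiftˡ X Y 3                         = trans (cong (X 2 * Y 0 +_) (ℚ.*-zeroˡ (Y 1))) (ℚ.+-identityʳ _)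
conv-shiftˡ X Y (suc (suc (suc (suc s)))) = cong (X (3 ℕ.+ s) * Y 0 +_) (conv-shiftˡ X (Y ∘ suc) (suc s))

conv-shiftʳ : ∀ X Y s → conv X (shift Y) s ≡ shift (shift (shift (conv X Y))) s
conv-shiftʳ X Y 0                   = ℚ.*-zeroʳ (X 0)
conv-shiftʳ X Y 1                   = ℚ.*-zeroʳ (X 1)
conv-shiftʳ X Y 2                   = ℚ.*-zeroʳ (X 2)
conv-shiftʳ X Y (suc (suc (suc s))) = trans (cong (_+ conv X Y s) (ℚ.*-zeroʳ (X (3 ℕ.+ s)))) (ℚ.+-identityˡ _)

∑-shift³ : ∀ A f → ∑ A (shift (shift (shift f))) ≡ ∑ (A ∸ 3) f
∑-shift³ 0                   f = refl
∑-shift³ 1                   f = refl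
∑-shift³ 2                   f = refl
∑-shift³ (suc (suc (suc A))) f = trans (ℚ.+-identityˡ _) (trans (ℚ.+-identityˡ _) (ℚ.+-identityˡ _))

∑-truncate : ∀ {n m} (f : ℕ → ℚ) → n ℕ.≤ m → (∀ i → n ℕ.≤ i → f i ≡ 0ℚ) → ∑ m f ≡ ∑ n f
∑-truncate {n} {m} f n≤m f≡0 = begin
  ∑ m f                  ≡⟨ cong (λ k → ∑ k f) (sym (ℕ.m+[n∸m]≡n n≤m)) ⟩
  ∑ (n ℕ.+ (m ∸ n)) f    ≡⟨ ∑-vanishing-tail n (m ∸ n) f f≡0 ⟩
  ∑ n f                  ∎

∑-∑₃ : ∀ B A t → A ℕ.≤ 3 ℕ.* B → (∀ m n → A ℕ.≤ m ℕ.+ 3 ℕ.* n → t m n ≡ 0ℚ) →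
       ∑ A (∑₃ t) ≡ ∑ A (λ m → ∑ B (t m))
∑-∑₃ zero    .0 t z≤n t≡0 = refl
∑-∑₃ (suc B) A  t A≤3B+3 t≡0 = begin
  ∑ A (∑₃ t)                                        ≡⟨ ∑-cong A (∑₃-split t) ⟩
  ∑ A (λ s → t s 0 + shift (shift (shift (∑₃ t⁺))) s) ≡⟨ ∑-+ A _ _ ⟩
  ∑ A (λ s → t s 0) + ∑ A (shift (shift (shift (∑₃ t⁺))))
                                                    ≡⟨ cong (∑ A (λ s → t s 0) +_) (∑-shift³ A (∑₃ t⁺)) ⟩
  ∑ A (λ s → t s 0) + ∑ (A ∸ 3) (∑₃ t⁺)              ≡⟨ cong (∑ A (λ s → t s 0) +_) (∑-∑₃ B (A ∸ 3) t⁺ A∸3≤3B t⁺≡0) ⟩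
  ∑ A (λ s → t s 0) + ∑ (A ∸ 3) (λ m → ∑ B (t⁺ m))   ≡⟨ cong (∑ A (λ s → t s 0) +_) (sym (∑-truncate _ (ℕ.m∸n≤m A 3) row≡0)) ⟩
  ∑ A (λ s → t s 0) + ∑ A (λ m → ∑ B (t⁺ m))         ≡⟨ sym (∑-+ A _ _) ⟩
  ∑ A (λ m → ∑ (suc B) (t m))                        ∎
  where
  t⁺ : ℕ → ℕ → ℚ
  t⁺ m n = t m (suc n)
  A∸3≤3B : A ∸ 3 ℕ.≤ 3 ℕ.* B
  A∸3≤3B = subst (A ∸ 3 ℕ.≤_) (ℕ.m+n∸m≡n 3 (3 ℕ.* B)) (ℕ.∸-monoˡ-≤ 3 (subst (A ℕ.≤_) (ℕ.*-suc 3 B) A≤3B+3))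
  t⁺≡0 : ∀ m n → A ∸ 3 ℕ.≤ m ℕ.+ 3 ℕ.* n → t⁺ m n ≡ 0ℚ
  t⁺≡0 m n le = t≡0 m (suc n) (subst (A ℕ.≤_) (sym (m+3[1+n]≡3+[m+3n] m n))
                                     (ℕ.≤-trans (ℕ.m≤n+m∸n A 3) (ℕ.+-monoʳ-≤ 3 le)))
  row≡0 : ∀ m → A ∸ 3 ℕ.≤ m → ∑ B (t⁺ m) ≡ 0ℚ
  row≡0 m le = ∑-zero B (λ n → t⁺≡0 m n (ℕ.≤-trans le (ℕ.m≤m+n m _)))

-- ∑₁ t K = Σ_{M + s = K} t M s
∑₁ : (ℕ → ℕ → ℚ) → ℕ → ℚ
∑₁ t zero    = t 0 0
∑₁ t (suc K) = t (suc K) 0 + ∑₁ (λ M s → t M (suc s)) K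

∑₁-cong-on : ∀ K {t u : ℕ → ℕ → ℚ} → (∀ M s → M ℕ.+ s ≡ K → t M s ≡ u M s) → ∑₁ t K ≡ ∑₁ u K
∑₁-cong-on zero    t≡u = t≡u 0 0 refl
∑₁-cong-on (suc K) t≡u =
  cong₂ _+_ (t≡u (suc K) 0 (ℕ.+-identityʳ _)) (∑₁-cong-on K (λ M s eq → t≡u M (suc s) (trans (ℕ.+-suc M s) (cong suc eq))))

∑₁-+-* : ∀ K (t u : ℕ → ℕ → ℚ) c → ∑₁ (λ M s → t M s + c * u M s) K ≡ ∑₁ t K + c * ∑₁ u K
∑₁-+-* zero    t u c = refl
∑₁-+-* (suc K) t u c = begin
  (t (suc K) 0 + c * u (suc K) 0) + ∑₁ (λ M s → t M (suc s) + c * u M (suc s)) K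
    ≡⟨ cong ((t (suc K) 0 + c * u (suc K) 0) +_) (∑₁-+-* K _ _ c) ⟩
  (t (suc K) 0 + c * u (suc K) 0) + (∑₁ (λ M s → t M (suc s)) K + c * ∑₁ (λ M s → u M (suc s)) K)
    ≡⟨ regroup (t (suc K) 0) (u (suc K) 0) _ _ c ⟩
  (t (suc K) 0 + ∑₁ (λ M s → t M (suc s)) K) + c * (u (suc K) 0 + ∑₁ (λ M s → u M (suc s)) K) ∎
  where
  regroup : ∀ a b x y c → (a + c * b) + (x + c * y) ≡ (a + x) + c * (b + y)
  regroup = solve-∀ ℚ-ring

∑₁-sucʳ : ∀ K t → ∑₁ t (suc K) ≡ ∑₁ (λ M s → t (suc M) s) K + t 0 (suc K)
∑₁-sucʳ zero    t = refl
∑₁-sucʳ (suc K) t = begin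
  t (2 ℕ.+ K) 0 + ∑₁ (λ M s → t M (suc s)) (suc K)
    ≡⟨ cong (t (2 ℕ.+ K) 0 +_) (∑₁-sucʳ K (λ M s → t M (suc s))) ⟩
  t (2 ℕ.+ K) 0 + (∑₁ (λ M s → t (suc M) (suc s)) K + t 0 (2 ℕ.+ K))
    ≡⟨ sym (ℚ.+-assoc (t (2 ℕ.+ K) 0) _ _) ⟩
  (t (2 ℕ.+ K) 0 + ∑₁ (λ M s → t (suc M) (suc s)) K) + t 0 (2 ℕ.+ K) ∎

∑₁-shift : ∀ K (v : ℕ → ℕ → ℚ) → ∑₁ (λ M → shift (v M)) (suc K) ≡ ∑₁ v K
∑₁-shift K v = ℚ.+-identityˡ (∑₁ v K)

∑₁≡∑ : ∀ K t → ∑₁ t K ≡ ∑ (suc K) (λ s → t (K ∸ s) s)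
∑₁≡∑ zero    t = sym (ℚ.+-identityʳ (t 0 0))
∑₁≡∑ (suc K) t = cong (t (suc K) 0 +_) (∑₁≡∑ K (λ M s → t M (suc s)))

-- The g side

binom2 : ℕ → ℕ
binom2 zero    = 0
binom2 (suc n) = binom2 n ℕ.+ n

sign : ℕ → ℚ
sign n = pow (- 1ℚ) n

module _ (q : ℚ) where

  -- Coefficients of xⁱ in (−x;q)_M.
  pochCoeff : ℕ → ℕ → ℚ
  pochCoeff M i = pow q (binom2 i) * qbinom q M i

  -- Coefficients of yⁿ in 1/(−y;q³)_M.
  recipCoeff : ℕ → ℕ → ℚ
  recipCoeff zero    zero    = 1ℚ
  recipCoeff zero    (suc n) = 0ℚ
  recipCoeff (suc M) n       = sign n * qbinom (pow q 3) (n ℕ.+ M) n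

  -- Coefficients of xˢ in E_M = (−x;q)_M / (−x³;q³)_M.
  quotCoeff : ℕ → ℕ → ℚ
  quotCoeff M = conv (pochCoeff M) (recipCoeff M)

  weight : ℕ → ℚ
  weight s = pow q (binom2 (suc s))

  term : ℕ → ℕ → ℚ
  term M s = weight s * quotCoeff M s

  -- g 0 = 0 matches F_(−1)(0,1,1;1) = 0.
  g : ℕ → ℚ
  g zero    = 0ℚ
  g (suc K) = ∑₁ (λ M → term (suc M)) K

  pochCoeff-vanish : ∀ {M i} → M ℕ.< i → pochCoeff M i ≡ 0ℚ
  pochCoeff-vanish {M} {i} M<i = trans (cong (pow q (binom2 i) *_) (qbinom-vanish q M<i)) (ℚ.*-zeroʳ (pow q (binom2 i)))

  -- (−x;q)_(M+1) = (1 + q^M x) (−x;q)_M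
  pochCoeff-rec : ∀ M i → pochCoeff (suc M) i ≡ pochCoeff M i + pow q M * shift (pochCoeff M) i
  pochCoeff-rec M zero = sym (cong (1ℚ +_) (ℚ.*-zeroʳ (pow q M)))
  pochCoeff-rec M (suc k) with k ℕ.≤? M
  ... | yes k≤M = subst (λ n → pochCoeff (suc n) (suc k) ≡ pochCoeff n (suc k) + pow q n * pochCoeff n k)
                        (ℕ.m+[n∸m]≡n k≤M) (pascal k (M ∸ k))
    where
    pascal : ∀ k d → pochCoeff (suc (k ℕ.+ d)) (suc k) ≡ pochCoeff (k ℕ.+ d) (suc k) + pow q (k ℕ.+ d) * pochCoeff (k ℕ.+ d) k
    pascal k d = begin
      pow q (binom2 k ℕ.+ k) * qbinom q (suc (k ℕ.+ d)) (suc k)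
        ≡⟨ cong₂ _*_ (pow-+ q (binom2 k) k) (qbinom-pascal′ q k d) ⟩
      (pow q (binom2 k) * pow q k) * (qbinom q (k ℕ.+ d) (suc k) + pow q d * qbinom q (k ℕ.+ d) k)
        ≡⟨ distrib (pow q (binom2 k)) (pow q k) (pow q d) _ _ ⟩
      (pow q (binom2 k) * pow q k) * qbinom q (k ℕ.+ d) (suc k) + (pow q k * pow q d) * (pow q (binom2 k) * qbinom q (k ℕ.+ d) k)
        ≡⟨ sym (cong₂ (λ a b → a * qbinom q (k ℕ.+ d) (suc k) + b * pochCoeff (k ℕ.+ d) k) (pow-+ q (binom2 k) k) (pow-+ q k d)) ⟩
      pochCoeff (k ℕ.+ d) (suc k) + pow q (k ℕ.+ d) * pochCoeff (k ℕ.+ d) k ∎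
      where
      distrib : ∀ t a b x y → (t * a) * (x + b * y) ≡ (t * a) * x + (a * b) * (t * y)
      distrib = solve-∀ ℚ-ring
  ... | no k≰M = begin
    pochCoeff (suc M) (suc k)                         ≡⟨ pochCoeff-vanish (s≤s M<k) ⟩
    0ℚ                                                ≡⟨ sym (ℚ.*-zeroʳ (pow q M)) ⟩
    pow q M * 0ℚ                                      ≡⟨ sym (ℚ.+-identityˡ _) ⟩
    0ℚ + pow q M * 0ℚ                                 ≡⟨ sym (cong₂ (λ a b → a + pow q M * b) vanish₁ vanish₂) ⟩
    pochCoeff M (suc k) + pow q M * pochCoeff M k     ∎
    where
    M<k : M ℕ.< k
    M<k = ℕ.≰⇒> k≰M
    vanish₁ : pochCoeff M (suc k) ≡ 0ℚ
    vanish₁ = pochCoeff-vanish (ℕ.m<n⇒m<1+n M<k)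
    vanish₂ : pochCoeff M k ≡ 0ℚ
    vanish₂ = pochCoeff-vanish M<k

  -- 1/(−y;q³)_M = (1 + q^(3M) y) / (−y;q³)_(M+1)
  recipCoeff-rec : ∀ M n → recipCoeff M n ≡ recipCoeff (suc M) n + pow (pow q 3) M * shift (recipCoeff (suc M)) n
  recipCoeff-rec zero    zero    = refl
  recipCoeff-rec (suc M) zero    = sym (cong (1ℚ +_) (ℚ.*-zeroʳ (pow (pow q 3) (suc M))))
  recipCoeff-rec zero    (suc n) = begin
    0ℚ                                                 ≡⟨ cancel (sign n) ⟩
    sign n * (- 1ℚ) * 1ℚ + 1ℚ * (sign n * 1ℚ)           ≡⟨ sym (cong₂ (λ a b → sign n * (- 1ℚ) * a + 1ℚ * (sign n * b)) (B-diag (suc n)) (B-diag n)) ⟩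
    sign (suc n) * B (suc n ℕ.+ 0) (suc n) + 1ℚ * (sign n * B (n ℕ.+ 0) n) ∎
    where
    Q = pow q 3
    B = qbinom Q
    B-diag : ∀ m → B (m ℕ.+ 0) m ≡ 1ℚ
    B-diag m = trans (cong (λ k → B k m) (ℕ.+-identityʳ m)) (qbinom-diag Q m)
    cancel : ∀ s → 0ℚ ≡ s * (- 1ℚ) * 1ℚ + 1ℚ * (s * 1ℚ)
    cancel = solve-∀ ℚ-ring
  recipCoeff-rec (suc M) (suc n) = begin
    sign (suc n) * B (suc (n ℕ.+ M)) (suc n)
      ≡⟨ cong (λ k → sign (suc n) * B k (suc n)) (sym (ℕ.+-suc n M)) ⟩
    sign n * (- 1ℚ) * B (n ℕ.+ suc M) (suc n)
      ≡⟨ split (sign n) (pow Q (suc M)) (B (n ℕ.+ suc M) (suc n)) (B (n ℕ.+ suc M) n) ⟩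
    sign n * (- 1ℚ) * (B (n ℕ.+ suc M) (suc n) + pow Q (suc M) * B (n ℕ.+ suc M) n) + pow Q (suc M) * (sign n * B (n ℕ.+ suc M) n)
      ≡⟨ cong (λ x → sign n * (- 1ℚ) * x + pow Q (suc M) * (sign n * B (n ℕ.+ suc M) n)) (sym (qbinom-pascal′ Q n (suc M))) ⟩
    sign (suc n) * B (suc (n ℕ.+ suc M)) (suc n) + pow Q (suc M) * (sign n * B (n ℕ.+ suc M) n) ∎
    where
    Q = pow q 3
    B = qbinom Q
    split : ∀ s P Y Z → s * (- 1ℚ) * Y ≡ s * (- 1ℚ) * (Y + P * Z) + P * (s * Z)
    split = solve-∀ ℚ-ring

  -- E_M and E_(M+1) are Z := (−x;q)_M / (−x³;q³)_(M+1) times 1 + a³x³ and 1 + ax (a = q^M);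
  -- since 1 + a³x³ = (1 − ax + a²x²)(1 + ax), E_M = (1 − ax + a²x²) E_(M+1).
  quotCoeff-rec : ∀ M s → quotCoeff (suc M) s ≡
    quotCoeff M s + pow q M * shift (quotCoeff (suc M)) s - pow q M * pow q M * shift (shift (quotCoeff (suc M))) s
  quotCoeff-rec M s = begin
    quotCoeff (suc M) s
      ≡⟨ E′≡ s ⟩
    Z s + a * shift Z s
      ≡⟨ telescope (Z s) (shift Z s) (shift (shift Z) s) (shift (shift (shift Z)) s) a ⟩
    (Z s + a * a * a * Z³ s) + a * (shift Z s + a * shift (shift Z) s) - a * a * (shift (shift Z) s + a * Z³ s)
      ≡⟨ sym (cong₃ (λ x y z → x + a * y - a * a * z) (E≡ s) (shiftE′≡ s) (shift²E′≡ s)) ⟩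
    quotCoeff M s + a * shift (quotCoeff (suc M)) s - a * a * shift (shift (quotCoeff (suc M))) s ∎
    where
    a  = pow q M
    Y  = recipCoeff (suc M)
    Z  = conv (pochCoeff M) Y
    Z³ = shift (shift (shift Z))
    E′≡ : ∀ s → quotCoeff (suc M) s ≡ Z s + a * shift Z s
    E′≡ s = begin
      conv (pochCoeff (suc M)) Y s                              ≡⟨ ∑₃-cong s (λ m n → cong (_* Y n) (pochCoeff-rec M m)) ⟩
      conv (λ m → pochCoeff M m + a * shift (pochCoeff M) m) Y s ≡⟨ conv-+-*ˡ (pochCoeff M) (shift (pochCoeff M)) Y a s ⟩
      Z s + a * conv (shift (pochCoeff M)) Y s                   ≡⟨ cong (λ x → Z s + a * x) (conv-shiftˡ (pochCoeff M) Y s) ⟩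
      Z s + a * shift Z s                                        ∎
    E≡ : ∀ s → quotCoeff M s ≡ Z s + a * a * a * Z³ s
    E≡ s = begin
      conv (pochCoeff M) (recipCoeff M) s                        ≡⟨ ∑₃-cong s (λ m n → cong (pochCoeff M m *_) (recipCoeff-rec M n)) ⟩
      conv (pochCoeff M) (λ n → Y n + pow (pow q 3) M * shift Y n) s
                                                                 ≡⟨ conv-+-*ʳ (pochCoeff M) Y (shift Y) (pow (pow q 3) M) s ⟩
      Z s + pow (pow q 3) M * conv (pochCoeff M) (shift Y) s     ≡⟨ cong₂ (λ c x → Z s + c * x) (pow-cube q M) (conv-shiftʳ (pochCoeff M) Y s) ⟩
      Z s + a * a * a * Z³ s                                     ∎
    shiftE′≡ : ∀ s → shift (quotCoeff (suc M)) s ≡ shift Z s + a * shift (shift Z) s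
    shiftE′≡ s = trans (shift-cong E′≡ s) (shift-+-* Z (shift Z) a s)
    shift²E′≡ : ∀ s → shift (shift (quotCoeff (suc M))) s ≡ shift (shift Z) s + a * Z³ s
    shift²E′≡ s = trans (shift-cong shiftE′≡ s) (shift-+-* (shift Z) (shift (shift Z)) a s)
    telescope : ∀ z z₁ z₂ z₃ a → z + a * z₁ ≡ (z + a * a * a * z₃) + a * (z₁ + a * z₂) - a * a * (z₂ + a * z₃)
    telescope = solve-∀ ℚ-ring

  weight-shift : ∀ {K M} s X → M ℕ.+ s ≡ suc K →
    weight s * (pow q M * shift X s) ≡ pow q (suc K) * shift (λ i → weight i * X i) s
  weight-shift {K} {M} zero X _ = *-zeroʳ-both (weight 0) (pow q M) (pow q (suc K))
  weight-shift {K} {M} (suc s) X eq = begin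
    weight (suc s) * (pow q M * X s)      ≡⟨ sym (ℚ.*-assoc (weight (suc s)) (pow q M) (X s)) ⟩
    weight (suc s) * pow q M * X s        ≡⟨ cong (_* X s) (trans (pow-+-≡ q {binom2 (2 ℕ.+ s)} {M} exponent) (pow-+ q (suc K) _)) ⟩
    pow q (suc K) * weight s * X s        ≡⟨ ℚ.*-assoc (pow q (suc K)) (weight s) (X s) ⟩
    pow q (suc K) * (weight s * X s)      ∎
    where
    exponent : binom2 (suc s) ℕ.+ suc s ℕ.+ M ≡ suc K ℕ.+ binom2 (suc s)
    exponent = trans (arith (binom2 (suc s)) s M) (cong (ℕ._+ binom2 (suc s)) eq)
      where
      arith : ∀ b s M → b ℕ.+ suc s ℕ.+ M ≡ M ℕ.+ suc s ℕ.+ b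
      arith = ℕ-solve-∀

  weight-shift² : ∀ {K M} s X → M ℕ.+ s ≡ suc K →
    weight s * (pow q M * pow q M * shift (shift X) s) ≡ pow q (suc (K ℕ.+ K)) * shift (shift (λ i → weight i * X i)) s
  weight-shift² {K} {M} zero       X _ = *-zeroʳ-both (weight 0) (pow q M * pow q M) (pow q (suc (K ℕ.+ K)))
  weight-shift² {K} {M} (suc zero) X _ = *-zeroʳ-both (weight 1) (pow q M * pow q M) (pow q (suc (K ℕ.+ K)))
  weight-shift² {K} {M} (suc (suc s)) X eq = begin
    weight (2 ℕ.+ s) * (pow q M * pow q M * X s)        ≡⟨ regroup (weight (2 ℕ.+ s)) (pow q M) (X s) ⟩
    weight (2 ℕ.+ s) * (pow q M * pow q M) * X s        ≡⟨ cong (λ a → weight (2 ℕ.+ s) * a * X s) (pow-+-≡ q {M} {M} refl) ⟩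
    weight (2 ℕ.+ s) * pow q (M ℕ.+ M) * X s            ≡⟨ cong (_* X s) (trans (pow-+-≡ q {binom2 (3 ℕ.+ s)} {M ℕ.+ M} exponent) (pow-+ q (suc (K ℕ.+ K)) _)) ⟩
    pow q (suc (K ℕ.+ K)) * weight s * X s              ≡⟨ ℚ.*-assoc (pow q (suc (K ℕ.+ K))) (weight s) (X s) ⟩
    pow q (suc (K ℕ.+ K)) * (weight s * X s)            ∎
    where
    regroup : ∀ w a x → w * (a * a * x) ≡ w * (a * a) * x
    regroup = solve-∀ ℚ-ring
    K≡ : K ≡ M ℕ.+ suc s
    K≡ = sym (ℕ.suc-injective (trans (sym (ℕ.+-suc M (suc s))) eq))
    exponent : binom2 (suc s) ℕ.+ suc s ℕ.+ suc (suc s) ℕ.+ (M ℕ.+ M) ≡ suc (K ℕ.+ K) ℕ.+ binom2 (suc s)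
    exponent = trans (arith (binom2 (suc s)) s M) (cong (λ k → suc (k ℕ.+ k) ℕ.+ binom2 (suc s)) (sym K≡))
      where
      arith : ∀ b s M → b ℕ.+ suc s ℕ.+ suc (suc s) ℕ.+ (M ℕ.+ M) ≡ suc ((M ℕ.+ suc s) ℕ.+ (M ℕ.+ suc s)) ℕ.+ b
      arith = ℕ-solve-∀

  term-rec : ∀ K M s → M ℕ.+ s ≡ suc K →
    term (suc M) s ≡ term M s + pow q (suc K) * shift (term (suc M)) s - pow q (suc (K ℕ.+ K)) * shift (shift (term (suc M))) s
  term-rec K M s eq = begin
    weight s * quotCoeff (suc M) s
      ≡⟨ cong (weight s *_) (quotCoeff-rec M s) ⟩
    weight s * (quotCoeff M s + a * E₁ - a * a * E₂)
      ≡⟨ distrib (weight s) (quotCoeff M s) a E₁ E₂ ⟩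
    term M s + weight s * (a * E₁) - weight s * (a * a * E₂)
      ≡⟨ cong₂ (λ x y → term M s + x - y) (weight-shift s (quotCoeff (suc M)) eq) (weight-shift² s (quotCoeff (suc M)) eq) ⟩
    term M s + pow q (suc K) * shift (term (suc M)) s - pow q (suc (K ℕ.+ K)) * shift (shift (term (suc M))) s ∎
    where
    a  = pow q M
    E₁ = shift (quotCoeff (suc M)) s
    E₂ = shift (shift (quotCoeff (suc M))) s
    distrib : ∀ w e a x y → w * (e + a * x - a * a * y) ≡ w * e + w * (a * x) - w * (a * a * y)
    distrib = solve-∀ ℚ-ring

  pochCoeff₀*recipCoeff₀ : ∀ m n → 0 ℕ.< m ℕ.+ 3 ℕ.* n → pochCoeff 0 m * recipCoeff 0 n ≡ 0ℚ
  pochCoeff₀*recipCoeff₀ (suc m) n _ =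
    trans (cong (_* recipCoeff 0 n) (pochCoeff-vanish {0} {suc m} (s≤s z≤n))) (ℚ.*-zeroˡ (recipCoeff 0 n))
  pochCoeff₀*recipCoeff₀ zero (suc n) _ = ℚ.*-zeroʳ (pochCoeff 0 0)

  quotCoeff-zero : ∀ s → quotCoeff 0 (suc s) ≡ 0ℚ
  quotCoeff-zero s = ∑₃-zero (suc s) (λ m n eq → pochCoeff₀*recipCoeff₀ m n (subst (0 ℕ.<_) (sym eq) (s≤s z≤n)))

  ∑₁-term≡g : ∀ k → ∑₁ term (suc k) ≡ g (suc k)
  ∑₁-term≡g k = begin
    ∑₁ term (suc k)                          ≡⟨ ∑₁-sucʳ k term ⟩
    g (suc k) + weight (suc k) * quotCoeff 0 (suc k)
                                             ≡⟨ cong (λ x → g (suc k) + weight (suc k) * x) (quotCoeff-zero k) ⟩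
    g (suc k) + weight (suc k) * 0ℚ          ≡⟨ trans (cong (g (suc k) +_) (ℚ.*-zeroʳ (weight (suc k)))) (ℚ.+-identityʳ (g (suc k))) ⟩
    g (suc k)                                ∎

  ∑₁-shift-term≡g : ∀ k → ∑₁ (λ M → shift (term (suc M))) k ≡ g k
  ∑₁-shift-term≡g zero    = refl
  ∑₁-shift-term≡g (suc k) = ∑₁-shift k (λ M → term (suc M))

  g-rec : ∀ k → g (suc (suc k)) ≡ (1ℚ + pow q (suc k)) * g (suc k) - pow q (suc (k ℕ.+ k)) * g k
  g-rec k = begin
    ∑₁ (λ M → term (suc M)) (suc k)
      ≡⟨ ∑₁-cong-on (suc k) (λ M s eq → trans (term-rec k M s eq) (sub-as-add (term M s) A (T₁ M s) B (T₂ M s))) ⟩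
    ∑₁ (λ M s → (term M s + A * T₁ M s) + (- B) * T₂ M s) (suc k)
      ≡⟨ ∑₁-+-* (suc k) (λ M s → term M s + A * T₁ M s) T₂ (- B) ⟩
    ∑₁ (λ M s → term M s + A * T₁ M s) (suc k) + (- B) * ∑₁ T₂ (suc k)
      ≡⟨ cong₂ (λ x y → x + (- B) * y) (∑₁-+-* (suc k) term T₁ A) (∑₁-shift k T₁) ⟩
    (∑₁ term (suc k) + A * ∑₁ T₁ (suc k)) + (- B) * ∑₁ T₁ k
      ≡⟨ cong₃ (λ x y z → (x + A * y) + (- B) * z) (∑₁-term≡g k) (∑₁-shift k (λ M → term (suc M))) (∑₁-shift-term≡g k) ⟩
    (g (suc k) + A * g (suc k)) + (- B) * g k
      ≡⟨ collect (g (suc k)) (g k) A B ⟩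
    (1ℚ + A) * g (suc k) - B * g k ∎
    where
    T₁ = λ M → shift (term (suc M))
    T₂ = λ M → shift (shift (term (suc M)))
    A = pow q (suc k)
    B = pow q (suc (k ℕ.+ k))
    sub-as-add : ∀ x a y b z → x + a * y - b * z ≡ (x + a * y) + (- b) * z
    sub-as-add = solve-∀ ℚ-ring
    collect : ∀ g₁ g₀ A B → (g₁ + A * g₁) + (- B) * g₀ ≡ (1ℚ + A) * g₁ - B * g₀
    collect = solve-∀ ℚ-ring

-- F_N(0,1,1;1) = g (N + 1)

C2≡binom2 : ∀ n → n C 2 ≡ binom2 n
C2≡binom2 zero    = refl
C2≡binom2 (suc n) = begin
  suc n C 2             ≡⟨ sym (nCk+nC[k+1]≡[n+1]C[k+1] n 1) ⟩
  n C 1 ℕ.+ n C 2       ≡⟨ cong₂ ℕ._+_ (nC1≡n n) (C2≡binom2 n) ⟩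
  n ℕ.+ binom2 n        ≡⟨ ℕ.+-comm n (binom2 n) ⟩
  binom2 (suc n)        ∎

binom2-+ : ∀ a b → binom2 (a ℕ.+ b) ≡ binom2 a ℕ.+ binom2 b ℕ.+ a ℕ.* b
binom2-+ a zero    = trans (cong binom2 (ℕ.+-identityʳ a)) (arith (binom2 a) a)
  where
  arith : ∀ x a → x ≡ x ℕ.+ 0 ℕ.+ a ℕ.* 0
  arith = ℕ-solve-∀
binom2-+ a (suc b) = begin
  binom2 (a ℕ.+ suc b)                                  ≡⟨ cong binom2 (ℕ.+-suc a b) ⟩
  binom2 (a ℕ.+ b) ℕ.+ (a ℕ.+ b)                        ≡⟨ cong (ℕ._+ (a ℕ.+ b)) (binom2-+ a b) ⟩
  binom2 a ℕ.+ binom2 b ℕ.+ a ℕ.* b ℕ.+ (a ℕ.+ b)       ≡⟨ arith (binom2 a) (binom2 b) a b ⟩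
  binom2 a ℕ.+ (binom2 b ℕ.+ b) ℕ.+ a ℕ.* suc b         ∎
  where
  arith : ∀ x y a b → x ℕ.+ y ℕ.+ a ℕ.* b ℕ.+ (a ℕ.+ b) ≡ x ℕ.+ (y ℕ.+ b) ℕ.+ a ℕ.* suc b
  arith = ℕ-solve-∀

binom2-square : ∀ m → m ℕ.* m ≡ binom2 m ℕ.+ binom2 m ℕ.+ m
binom2-square zero    = refl
binom2-square (suc m) = begin
  suc m ℕ.* suc m                                        ≡⟨ square m ⟩
  m ℕ.* m ℕ.+ (m ℕ.+ m) ℕ.+ 1                            ≡⟨ cong (λ x → x ℕ.+ (m ℕ.+ m) ℕ.+ 1) (binom2-square m) ⟩
  binom2 m ℕ.+ binom2 m ℕ.+ m ℕ.+ (m ℕ.+ m) ℕ.+ 1        ≡⟨ regroup (binom2 m) m ⟩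
  (binom2 m ℕ.+ m) ℕ.+ (binom2 m ℕ.+ m) ℕ.+ suc m        ∎
  where
  square : ∀ m → suc m ℕ.* suc m ≡ m ℕ.* m ℕ.+ (m ℕ.+ m) ℕ.+ 1
  square = ℕ-solve-∀
  regroup : ∀ t m → t ℕ.+ t ℕ.+ m ℕ.+ (m ℕ.+ m) ℕ.+ 1 ≡ (t ℕ.+ m) ℕ.+ (t ℕ.+ m) ℕ.+ suc m
  regroup = ℕ-solve-∀

F-exponent : ∀ m n → (3 ℕ.* n ℕ.+ 1) C 2 ℕ.+ m ℕ.* m ℕ.+ 3 ℕ.* m ℕ.* n ≡ binom2 (suc (m ℕ.+ 3 ℕ.* n)) ℕ.+ binom2 m
F-exponent m n = begin
  (3 ℕ.* n ℕ.+ 1) C 2 ℕ.+ m ℕ.* m ℕ.+ 3 ℕ.* m ℕ.* n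
    ≡⟨ cong₂ (λ u v → u ℕ.+ v ℕ.+ 3 ℕ.* m ℕ.* n) (C2≡binom2 (3 ℕ.* n ℕ.+ 1)) (binom2-square m) ⟩
  binom2 (3 ℕ.* n ℕ.+ 1) ℕ.+ (binom2 m ℕ.+ binom2 m ℕ.+ m) ℕ.+ 3 ℕ.* m ℕ.* n
    ≡⟨ regroup (binom2 m) (binom2 (3 ℕ.* n ℕ.+ 1)) m n ⟩
  binom2 m ℕ.+ binom2 (3 ℕ.* n ℕ.+ 1) ℕ.+ m ℕ.* (3 ℕ.* n ℕ.+ 1) ℕ.+ binom2 m
    ≡⟨ cong (ℕ._+ binom2 m) (sym (binom2-+ m (3 ℕ.* n ℕ.+ 1))) ⟩
  binom2 (m ℕ.+ (3 ℕ.* n ℕ.+ 1)) ℕ.+ binom2 m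
    ≡⟨ cong (λ k → binom2 k ℕ.+ binom2 m) (shuffle m n) ⟩
  binom2 (suc (m ℕ.+ 3 ℕ.* n)) ℕ.+ binom2 m ∎
  where
  regroup : ∀ a b m n → b ℕ.+ (a ℕ.+ a ℕ.+ m) ℕ.+ 3 ℕ.* m ℕ.* n ≡ a ℕ.+ b ℕ.+ m ℕ.* (3 ℕ.* n ℕ.+ 1) ℕ.+ a
  regroup = ℕ-solve-∀
  shuffle : ∀ m n → m ℕ.+ (3 ℕ.* n ℕ.+ 1) ≡ suc (m ℕ.+ 3 ℕ.* n)
  shuffle = ℕ-solve-∀

gbinℕ-vanish : ∀ q {A B} → A ℕ.< B → gbinℕ q A B ≡ 0ℚ
gbinℕ-vanish q {A} {B} A<B with B ℕ.≤? A
... | yes B≤A = ⊥-elim (ℕ.<⇒≱ A<B B≤A)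
... | no  _   = refl

gbin-⊖-≥ : ∀ q {a b} k → b ℕ.≤ a → gbin q (a ⊖ b) (ℤ.+ k) ≡ gbinℕ q (a ∸ b) k
gbin-⊖-≥ q k b≤a = cong (λ z → gbin q z (ℤ.+ k)) (ℤ.⊖-≥ b≤a)

gbin-⊖-< : ∀ q {a b} k → a ℕ.< b → gbin q (a ⊖ b) (ℤ.+ k) ≡ 0ℚ
gbin-⊖-< q {zero}  {suc b} k _         = refl
gbin-⊖-< q {suc a} {suc b} k (s≤s a<b) =
  trans (cong (λ z → gbin q z (ℤ.+ k)) (ℤ.[1+m]⊖[1+n]≡m⊖n a b)) (gbin-⊖-< q k a<b)

F-index₁ : ∀ N m n → ℤ.+ N ℤ.- ℤ.+ (3 ℕ.* n) ℤ.- ℤ.+ m ℤ.+ ℤ.+ 1 ≡ suc N ⊖ (m ℕ.+ 3 ℕ.* n)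
F-index₁ N m n = begin
  ℤ.+ N ℤ.- ℤ.+ (3 ℕ.* n) ℤ.- ℤ.+ m ℤ.+ ℤ.+ 1      ≡⟨ regroup (ℤ.+ N) (ℤ.+ (3 ℕ.* n)) (ℤ.+ m) ⟩
  (ℤ.+ N ℤ.+ ℤ.+ 1) ℤ.- (ℤ.+ m ℤ.+ ℤ.+ (3 ℕ.* n))  ≡⟨ cong₂ ℤ._-_ (sym (ℤ.pos-+ N 1)) (sym (ℤ.pos-+ m (3 ℕ.* n))) ⟩
  ℤ.+ (N ℕ.+ 1) ℤ.- ℤ.+ (m ℕ.+ 3 ℕ.* n)            ≡⟨ cong (λ k → ℤ.+ k ℤ.- ℤ.+ (m ℕ.+ 3 ℕ.* n)) (ℕ.+-comm N 1) ⟩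
  ℤ.+ suc N ℤ.- ℤ.+ (m ℕ.+ 3 ℕ.* n)                ≡⟨ ℤ.m-n≡m⊖n (suc N) (m ℕ.+ 3 ℕ.* n) ⟩
  suc N ⊖ (m ℕ.+ 3 ℕ.* n)                          ∎
  where
  regroup : ∀ x y z → x ℤ.- y ℤ.- z ℤ.+ ℤ.+ 1 ≡ (x ℤ.+ ℤ.+ 1) ℤ.- (z ℤ.+ y)
  regroup = ℤ-solve-∀

F-index₂ : ∀ N m n → ℤ.+ N ℤ.- ℤ.+ (2 ℕ.* n) ℤ.- ℤ.+ m ≡ N ⊖ (2 ℕ.* n ℕ.+ m)
F-index₂ N m n = begin
  ℤ.+ N ℤ.- ℤ.+ (2 ℕ.* n) ℤ.- ℤ.+ m        ≡⟨ regroup (ℤ.+ N) (ℤ.+ (2 ℕ.* n)) (ℤ.+ m) ⟩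
  ℤ.+ N ℤ.- (ℤ.+ (2 ℕ.* n) ℤ.+ ℤ.+ m)      ≡⟨ cong (ℤ._-_ (ℤ.+ N)) (sym (ℤ.pos-+ (2 ℕ.* n) m)) ⟩
  ℤ.+ N ℤ.- ℤ.+ (2 ℕ.* n ℕ.+ m)            ≡⟨ ℤ.m-n≡m⊖n N (2 ℕ.* n ℕ.+ m) ⟩
  N ⊖ (2 ℕ.* n ℕ.+ m)                      ∎
  where
  regroup : ∀ x y z → x ℤ.- y ℤ.- z ≡ x ℤ.- (y ℤ.+ z)
  regroup = ℤ-solve-∀

F-term : ℚ → ℕ → ℕ → ℕ → ℚ
F-term q N m n = pow (- 1ℚ) n
  * pow q ((3 ℕ.* n ℕ.+ 1) C 2 ℕ.+ m ℕ.* m ℕ.+ 3 ℕ.* m ℕ.* n)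
  * pow 1ℚ (m ℕ.+ 3 ℕ.* n)
  * gbin q (ℤ.+ N ℤ.- ℤ.+ (3 ℕ.* n) ℤ.- ℤ.+ m ℤ.+ ℤ.+ 1) (ℤ.+ m)
  * gbin (pow q 3) (ℤ.+ N ℤ.- ℤ.+ (2 ℕ.* n) ℤ.- ℤ.+ m) (ℤ.+ n)

F011≡∑∑ : ∀ q N → F011 (ℤ.+ N) q 1ℚ ≡ ∑ (2 ℕ.+ N) (λ m → ∑ (2 ℕ.+ N) (F-term q N m))
F011≡∑∑ q N = trans (sumTo≡∑ (2 ℕ.+ N) (λ m → sumTo (2 ℕ.+ N) (F-term q N m)))
                    (∑-cong (2 ℕ.+ N) (λ m → sumTo≡∑ (2 ℕ.+ N) (F-term q N m)))

module _ (q : ℚ) where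

  F-binom₁ F-binom₂ F-binomials : ℕ → ℕ → ℕ → ℚ
  F-binom₁ N m n    = gbin q (suc N ⊖ (m ℕ.+ 3 ℕ.* n)) (ℤ.+ m)
  F-binom₂ N m n    = gbin (pow q 3) (N ⊖ (2 ℕ.* n ℕ.+ m)) (ℤ.+ n)
  F-binomials N m n = F-binom₁ N m n * F-binom₂ N m n

  F-term-form : ∀ N m n → F-term q N m n ≡ sign n * (weight q (m ℕ.+ 3 ℕ.* n) * pow q (binom2 m)) * F-binomials N m n
  F-term-form N m n = begin
    F-term q N m n
      ≡⟨ cong₃ (λ x y z → sign n * x * y * z * gbin (pow q 3) (ℤ.+ N ℤ.- ℤ.+ (2 ℕ.* n) ℤ.- ℤ.+ m) (ℤ.+ n))
               (trans (cong (pow q) (F-exponent m n)) (pow-+ q (binom2 (suc s)) (binom2 m))) (pow-1ℚ s) (cong (λ z → gbin q z (ℤ.+ m)) (F-index₁ N m n)) ⟩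
    sign n * (weight q s * pow q (binom2 m)) * 1ℚ * gbin q (suc N ⊖ s) (ℤ.+ m) * gbin (pow q 3) (ℤ.+ N ℤ.- ℤ.+ (2 ℕ.* n) ℤ.- ℤ.+ m) (ℤ.+ n)
      ≡⟨ cong (λ z → sign n * (weight q s * pow q (binom2 m)) * 1ℚ * gbin q (suc N ⊖ s) (ℤ.+ m) * gbin (pow q 3) z (ℤ.+ n)) (F-index₂ N m n) ⟩
    sign n * (weight q s * pow q (binom2 m)) * 1ℚ * gbin q (suc N ⊖ s) (ℤ.+ m) * gbin (pow q 3) (N ⊖ (2 ℕ.* n ℕ.+ m)) (ℤ.+ n)
      ≡⟨ regroup (sign n * (weight q s * pow q (binom2 m))) (F-binom₁ N m n) (F-binom₂ N m n) ⟩
    sign n * (weight q s * pow q (binom2 m)) * F-binomials N m n ∎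
    where
    s = m ℕ.+ 3 ℕ.* n
    regroup : ∀ c x y → c * 1ℚ * x * y ≡ c * (x * y)
    regroup = solve-∀ ℚ-ring

  F-binomials-vanish : ∀ N m n → N ℕ.< m ℕ.+ 3 ℕ.* n → F-binomials N m n ≡ 0ℚ
  F-binomials-vanish N m n N<s with ℕ.m≤n⇒m<n∨m≡n N<s
  ... | inj₁ N+1<s = trans (cong (_* F-binom₂ N m n) (gbin-⊖-< q m N+1<s)) (ℚ.*-zeroˡ (F-binom₂ N m n))
  F-binomials-vanish N (suc m) n N<s | inj₂ N+1≡s = trans (cong (_* F-binom₂ N (suc m) n) first≡0) (ℚ.*-zeroˡ (F-binom₂ N (suc m) n))
    where
    first≡0 : F-binom₁ N (suc m) n ≡ 0ℚ
    first≡0 = trans (cong (λ k → gbin q (suc N ⊖ k) (ℤ.+ suc m)) (sym N+1≡s))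
                    (trans (cong (λ z → gbin q z (ℤ.+ suc m)) (ℤ.n⊖n≡0 (suc N))) (gbinℕ-vanish q {0} {suc m} (s≤s z≤n)))
  F-binomials-vanish N zero (suc n) N<s | inj₂ N+1≡s =
    trans (cong (F-binom₁ N 0 (suc n) *_) second≡0) (ℚ.*-zeroʳ (F-binom₁ N 0 (suc n)))
    where
    N≡2n+2+n : N ≡ 2 ℕ.* suc n ℕ.+ 0 ℕ.+ n
    N≡2n+2+n = ℕ.suc-injective (trans N+1≡s (arith n))
      where
      arith : ∀ n → 3 ℕ.* suc n ≡ suc (2 ℕ.* suc n ℕ.+ 0 ℕ.+ n)
      arith = ℕ-solve-∀
    second≡0 : F-binom₂ N 0 (suc n) ≡ 0ℚ
    second≡0 = begin
      gbin (pow q 3) (N ⊖ (2 ℕ.* suc n ℕ.+ 0)) (ℤ.+ suc n)        ≡⟨ gbin-⊖-≥ (pow q 3) (suc n) (subst (2 ℕ.* suc n ℕ.+ 0 ℕ.≤_) (sym N≡2n+2+n) (ℕ.m≤m+n _ n)) ⟩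
      gbinℕ (pow q 3) (N ∸ (2 ℕ.* suc n ℕ.+ 0)) (suc n)          ≡⟨ cong (λ k → gbinℕ (pow q 3) (k ∸ (2 ℕ.* suc n ℕ.+ 0)) (suc n)) N≡2n+2+n ⟩
      gbinℕ (pow q 3) (2 ℕ.* suc n ℕ.+ 0 ℕ.+ n ∸ (2 ℕ.* suc n ℕ.+ 0)) (suc n)
                                                                  ≡⟨ cong (λ k → gbinℕ (pow q 3) k (suc n)) (ℕ.m+n∸m≡n (2 ℕ.* suc n ℕ.+ 0) n) ⟩
      gbinℕ (pow q 3) n (suc n)                                   ≡⟨ gbinℕ-vanish (pow q 3) (ℕ.n<1+n n) ⟩
      0ℚ                                                          ∎

  diagTerm : ℕ → ℕ → ℕ → ℚ
  diagTerm N m n = weight q (m ℕ.+ 3 ℕ.* n) * (pochCoeff q (suc N ∸ (m ℕ.+ 3 ℕ.* n)) m * recipCoeff q (suc N ∸ (m ℕ.+ 3 ℕ.* n)) n)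

  ∑₃-diagTerm : ∀ N s → ∑₃ (diagTerm N) s ≡ term q (suc N ∸ s) s
  ∑₃-diagTerm N s = trans (∑₃-cong-on s on-diagonal) (∑₃-*ˡ s (weight q s) _)
    where
    on-diagonal : ∀ m n → m ℕ.+ 3 ℕ.* n ≡ s → diagTerm N m n ≡ weight q s * (pochCoeff q (suc N ∸ s) m * recipCoeff q (suc N ∸ s) n)
    on-diagonal m n eq = cong (λ k → weight q k * (pochCoeff q (suc N ∸ k) m * recipCoeff q (suc N ∸ k) n)) eq

  diagTerm-vanish : ∀ N m n → N ℕ.< m ℕ.+ 3 ℕ.* n → diagTerm N m n ≡ 0ℚ
  diagTerm-vanish N m n N<s = begin
    diagTerm N m n                                 ≡⟨ cong (λ M → weight q s * (pochCoeff q M m * recipCoeff q M n)) (ℕ.m≤n⇒m∸n≡0 N<s) ⟩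
    weight q s * (pochCoeff q 0 m * recipCoeff q 0 n) ≡⟨ cong (weight q s *_) (pochCoeff₀*recipCoeff₀ q m n (ℕ.≤-trans (s≤s z≤n) N<s)) ⟩
    weight q s * 0ℚ                                ≡⟨ ℚ.*-zeroʳ (weight q s) ⟩
    0ℚ                                             ∎
    where
    s = m ℕ.+ 3 ℕ.* n

module _ {q : ℚ} (q↯ : NotRootOfUnity q) {N m n : ℕ} (s≤N : m ℕ.+ 3 ℕ.* n ℕ.≤ N) where

  F-binom₁-inside : F-binom₁ q N m n ≡ qbinom q (suc (N ∸ (m ℕ.+ 3 ℕ.* n))) m
  F-binom₁-inside = begin
    F-binom₁ q N m n                              ≡⟨ gbin-⊖-≥ q m (ℕ.m≤n⇒m≤1+n s≤N) ⟩
    gbinℕ q (suc N ∸ (m ℕ.+ 3 ℕ.* n)) m           ≡⟨ cong (λ k → gbinℕ q k m) (ℕ.+-∸-assoc 1 s≤N) ⟩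
    gbinℕ q (suc (N ∸ (m ℕ.+ 3 ℕ.* n))) m         ≡⟨ gbinℕ≡qbinom q↯ _ m ⟩
    qbinom q (suc (N ∸ (m ℕ.+ 3 ℕ.* n))) m        ∎

  F-binom₂-inside : F-binom₂ q N m n ≡ qbinom (pow q 3) (n ℕ.+ (N ∸ (m ℕ.+ 3 ℕ.* n))) n
  F-binom₂-inside = begin
    F-binom₂ q N m n                              ≡⟨ gbin-⊖-≥ (pow q 3) n (subst (2 ℕ.* n ℕ.+ m ℕ.≤_) (sym N≡) (ℕ.m≤m+n _ _)) ⟩
    gbinℕ (pow q 3) (N ∸ (2 ℕ.* n ℕ.+ m)) n       ≡⟨ cong (λ k → gbinℕ (pow q 3) (k ∸ (2 ℕ.* n ℕ.+ m)) n) N≡ ⟩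
    gbinℕ (pow q 3) (2 ℕ.* n ℕ.+ m ℕ.+ (n ℕ.+ D) ∸ (2 ℕ.* n ℕ.+ m)) n
                                                  ≡⟨ cong (λ k → gbinℕ (pow q 3) k n) (ℕ.m+n∸m≡n (2 ℕ.* n ℕ.+ m) (n ℕ.+ D)) ⟩
    gbinℕ (pow q 3) (n ℕ.+ D) n                   ≡⟨ gbinℕ≡qbinom (notRootOfUnity-pow 2 q↯) (n ℕ.+ D) n ⟩
    qbinom (pow q 3) (n ℕ.+ D) n                  ∎
    where
    D = N ∸ (m ℕ.+ 3 ℕ.* n)
    N≡ : N ≡ 2 ℕ.* n ℕ.+ m ℕ.+ (n ℕ.+ D)
    N≡ = trans (sym (ℕ.m+[n∸m]≡n s≤N)) (arith m n D)
      where
      arith : ∀ m n D → m ℕ.+ 3 ℕ.* n ℕ.+ D ≡ 2 ℕ.* n ℕ.+ m ℕ.+ (n ℕ.+ D)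
      arith = ℕ-solve-∀

module _ {q : ℚ} (q↯ : NotRootOfUnity q) where

  F-term≡diagTerm : ∀ N m n → F-term q N m n ≡ diagTerm q N m n
  F-term≡diagTerm N m n with m ℕ.+ 3 ℕ.* n ℕ.≤? N
  ... | no s≰N = begin
    F-term q N m n                ≡⟨ F-term-form q N m n ⟩
    c * F-binomials q N m n       ≡⟨ cong (c *_) (F-binomials-vanish q N m n (ℕ.≰⇒> s≰N)) ⟩
    c * 0ℚ                        ≡⟨ ℚ.*-zeroʳ c ⟩
    0ℚ                            ≡⟨ sym (diagTerm-vanish q N m n (ℕ.≰⇒> s≰N)) ⟩
    diagTerm q N m n              ∎
    where
    c = sign n * (weight q (m ℕ.+ 3 ℕ.* n) * pow q (binom2 m))
  ... | yes s≤N = begin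
    F-term q N m n
      ≡⟨ F-term-form q N m n ⟩
    sign n * (weight q s * pow q (binom2 m)) * (F-binom₁ q N m n * F-binom₂ q N m n)
      ≡⟨ cong₂ (λ x y → sign n * (weight q s * pow q (binom2 m)) * (x * y)) (F-binom₁-inside q↯ {N} {m} {n} s≤N) (F-binom₂-inside q↯ {N} {m} {n} s≤N) ⟩
    sign n * (weight q s * pow q (binom2 m)) * (qbinom q (suc D) m * qbinom (pow q 3) (n ℕ.+ D) n)
      ≡⟨ regroup (sign n) (weight q s) (pow q (binom2 m)) (qbinom q (suc D) m) (qbinom (pow q 3) (n ℕ.+ D) n) ⟩
    weight q s * (pochCoeff q (suc D) m * recipCoeff q (suc D) n)
      ≡⟨ cong (λ M → weight q s * (pochCoeff q M m * recipCoeff q M n)) (sym (ℕ.+-∸-assoc 1 s≤N)) ⟩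
    diagTerm q N m n ∎
    where
    s = m ℕ.+ 3 ℕ.* n
    D = N ∸ s
    regroup : ∀ σ w p x y → σ * (w * p) * (x * y) ≡ w * ((p * x) * (σ * y))
    regroup = solve-∀ ℚ-ring

  F011≡g : ∀ N → F011 (ℤ.+ N) q 1ℚ ≡ g q (suc N)
  F011≡g N = begin
    F011 (ℤ.+ N) q 1ℚ                              ≡⟨ F011≡∑∑ q N ⟩
    ∑ A (λ m → ∑ A (F-term q N m))                 ≡⟨ ∑-cong A (λ m → ∑-cong A (F-term≡diagTerm N m)) ⟩
    ∑ A (λ m → ∑ A (diagTerm q N m))               ≡⟨ sym (∑-∑₃ A A (diagTerm q N) (ℕ.m≤n*m A 3) vanish) ⟩
    ∑ A (∑₃ (diagTerm q N))                        ≡⟨ ∑-cong A (∑₃-diagTerm q N) ⟩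
    ∑ A (λ s → term q (suc N ∸ s) s)               ≡⟨ sym (∑₁≡∑ (suc N) (term q)) ⟩
    ∑₁ (term q) (suc N)                            ≡⟨ ∑₁-term≡g q N ⟩
    g q (suc N)                                    ∎
    where
    A = 2 ℕ.+ N
    vanish : ∀ m n → A ℕ.≤ m ℕ.+ 3 ℕ.* n → diagTerm q N m n ≡ 0ℚ
    vanish m n A≤s = diagTerm-vanish q N m n (ℕ.≤-trans (ℕ.n≤1+n (suc N)) A≤s)

  F011-pred≡g : ∀ N → F011 (ℤ.+ N ℤ.- ℤ.+ 1) q 1ℚ ≡ g q N
  F011-pred≡g zero    = refl
  F011-pred≡g (suc N) = F011≡g N

-- The f side

scale : ℚ → (ℕ → ℚ) → ℕ → ℚ
scale q a i = pow q i * a i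

-- (−x;q)_(N+1) = (1 + x) (−qx;q)_N
pochCoeff-rec′ : ∀ q N i → pochCoeff q (suc N) i ≡ scale q (pochCoeff q N) i + shift (scale q (pochCoeff q N)) i
pochCoeff-rec′ q N zero    = sym (ℚ.+-identityʳ (1ℚ * (1ℚ * 1ℚ)))
pochCoeff-rec′ q N (suc k) = begin
  pow q (binom2 k ℕ.+ k) * (pow q k * q * qbinom q N (suc k) + qbinom q N k)
    ≡⟨ cong (_* (pow q k * q * qbinom q N (suc k) + qbinom q N k)) (pow-+ q (binom2 k) k) ⟩
  (pow q (binom2 k) * pow q k) * (pow q k * q * qbinom q N (suc k) + qbinom q N k)
    ≡⟨ distrib (pow q (binom2 k)) (pow q k) q (qbinom q N (suc k)) (qbinom q N k) ⟩
  pow q k * q * ((pow q (binom2 k) * pow q k) * qbinom q N (suc k)) + pow q k * (pow q (binom2 k) * qbinom q N k)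
    ≡⟨ cong (λ x → pow q k * q * (x * qbinom q N (suc k)) + pow q k * pochCoeff q N k) (sym (pow-+ q (binom2 k) k)) ⟩
  pow q (suc k) * pochCoeff q N (suc k) + pow q k * pochCoeff q N k ∎
  where
  distrib : ∀ t k q b₁ b₀ → (t * k) * (k * q * b₁ + b₀) ≡ k * q * ((t * k) * b₁) + k * (t * b₀)
  distrib = solve-∀ ℚ-ring

f-exponent : ℕ → ℕ
f-exponent j = 3 ℕ.* j ℕ.* j ∸ 2 ℕ.* j

f-exponent-suc : ∀ j → f-exponent (suc j) ≡ f-exponent j ℕ.+ (6 ℕ.* j ℕ.+ 1)
f-exponent-suc j = ℕ.+-cancelʳ-≡ (2 ℕ.* suc j) _ _ (begin
  f-exponent (suc j) ℕ.+ 2 ℕ.* suc j                  ≡⟨ restore (suc j) ⟩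
  3 ℕ.* suc j ℕ.* suc j                               ≡⟨ square j ⟩
  3 ℕ.* j ℕ.* j ℕ.+ (6 ℕ.* j ℕ.+ 3)                   ≡⟨ cong (ℕ._+ (6 ℕ.* j ℕ.+ 3)) (sym (restore j)) ⟩
  f-exponent j ℕ.+ 2 ℕ.* j ℕ.+ (6 ℕ.* j ℕ.+ 3)        ≡⟨ regroup (f-exponent j) j ⟩
  f-exponent j ℕ.+ (6 ℕ.* j ℕ.+ 1) ℕ.+ 2 ℕ.* suc j    ∎)
  where
  restore : ∀ j → f-exponent j ℕ.+ 2 ℕ.* j ≡ 3 ℕ.* j ℕ.* j
  restore zero    = refl
  restore (suc j) = ℕ.m∸n+n≡m (subst (2 ℕ.* suc j ℕ.≤_) (sym (split j)) (ℕ.m≤m+n _ _))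
    where
    split : ∀ j → 3 ℕ.* suc j ℕ.* suc j ≡ 2 ℕ.* suc j ℕ.+ (1 ℕ.+ 3 ℕ.* j ℕ.* j ℕ.+ 4 ℕ.* j)
    split = ℕ-solve-∀
  square : ∀ j → 3 ℕ.* suc j ℕ.* suc j ≡ 3 ℕ.* j ℕ.* j ℕ.+ (6 ℕ.* j ℕ.+ 3)
  square = ℕ-solve-∀
  regroup : ∀ x j → x ℕ.+ 2 ℕ.* j ℕ.+ (6 ℕ.* j ℕ.+ 3) ≡ x ℕ.+ (6 ℕ.* j ℕ.+ 1) ℕ.+ 2 ℕ.* suc j
  regroup = ℕ-solve-∀

binom2-3[1+j] : ∀ j → binom2 (3 ℕ.* suc j) ≡ binom2 (3 ℕ.* j) ℕ.+ ((6 ℕ.* j ℕ.+ 1) ℕ.+ (3 ℕ.* j ℕ.+ 2))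
binom2-3[1+j] j = begin
  binom2 (3 ℕ.* suc j)                         ≡⟨ cong binom2 (trans (ℕ.*-suc 3 j) (ℕ.+-comm 3 (3 ℕ.* j))) ⟩
  binom2 (3 ℕ.* j ℕ.+ 3)                       ≡⟨ binom2-+ (3 ℕ.* j) 3 ⟩
  binom2 (3 ℕ.* j) ℕ.+ 3 ℕ.+ 3 ℕ.* j ℕ.* 3     ≡⟨ arith (binom2 (3 ℕ.* j)) j ⟩
  binom2 (3 ℕ.* j) ℕ.+ ((6 ℕ.* j ℕ.+ 1) ℕ.+ (3 ℕ.* j ℕ.+ 2)) ∎
  where
  arith : ∀ t j → t ℕ.+ 3 ℕ.+ 3 ℕ.* j ℕ.* 3 ≡ t ℕ.+ ((6 ℕ.* j ℕ.+ 1) ℕ.+ (3 ℕ.* j ℕ.+ 2))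
  arith = ℕ-solve-∀

module _ {q r : ℚ} (qr≡1 : q * r ≡ 1ℚ) where

  -- The j-th term of f_N is coeff j * pochCoeff q N (3j): the r-power cancels the q^binom2(3j) of pochCoeff.
  coeff : ℕ → ℚ
  coeff j = pow q (f-exponent j) * poch (pow q 2) (pow q 3) j * pow r (binom2 (3 ℕ.* j))

  coeff-suc : ∀ j → coeff (suc j) ≡ coeff j * (pow r (3 ℕ.* j ℕ.+ 2) - 1ℚ)
  coeff-suc j = begin
    pow q (f-exponent (suc j)) * (P * (1ℚ - pow q 2 * pow (pow q 3) j)) * pow r (binom2 (3 ℕ.* suc j))
      ≡⟨ cong₃ (λ x y z → x * (P * (1ℚ - y)) * z) q-part q²Q³ʲ r-part ⟩
    (pow q (f-exponent j) * qᵃ) * (P * (1ℚ - qᵇ)) * (rᵀ * (rᵃ * rᵇ))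
      ≡⟨ regroup (pow q (f-exponent j)) qᵃ rᵃ qᵇ rᵇ P rᵀ ⟩
    coeff j * ((qᵃ * rᵃ) * (rᵇ - qᵇ * rᵇ))
      ≡⟨ cong₂ (λ x y → coeff j * (x * (rᵇ - y))) (pow-inverse qr≡1 (6 ℕ.* j ℕ.+ 1)) (pow-inverse qr≡1 (3 ℕ.* j ℕ.+ 2)) ⟩
    coeff j * (1ℚ * (rᵇ - 1ℚ))
      ≡⟨ cong (coeff j *_) (ℚ.*-identityˡ (rᵇ - 1ℚ)) ⟩
    coeff j * (rᵇ - 1ℚ) ∎
    where
    P  = poch (pow q 2) (pow q 3) j
    qᵃ = pow q (6 ℕ.* j ℕ.+ 1)
    rᵃ = pow r (6 ℕ.* j ℕ.+ 1)
    qᵇ = pow q (3 ℕ.* j ℕ.+ 2)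
    rᵇ = pow r (3 ℕ.* j ℕ.+ 2)
    rᵀ = pow r (binom2 (3 ℕ.* j))
    q-part : pow q (f-exponent (suc j)) ≡ pow q (f-exponent j) * qᵃ
    q-part = trans (cong (pow q) (f-exponent-suc j)) (pow-+ q (f-exponent j) _)
    q²Q³ʲ : pow q 2 * pow (pow q 3) j ≡ qᵇ
    q²Q³ʲ = trans (cong (pow q 2 *_) (pow-pow q 3 j)) (pow-+-≡ q {2} {3 ℕ.* j} (ℕ.+-comm 2 (3 ℕ.* j)))
    r-part : pow r (binom2 (3 ℕ.* suc j)) ≡ rᵀ * (rᵃ * rᵇ)
    r-part = trans (cong (pow r) (binom2-3[1+j] j))
                   (trans (pow-+ r (binom2 (3 ℕ.* j)) _) (cong (rᵀ *_) (pow-+ r (6 ℕ.* j ℕ.+ 1) (3 ℕ.* j ℕ.+ 2))))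
    regroup : ∀ x qᵃ rᵃ qᵇ rᵇ P rᵀ → (x * qᵃ) * (P * (1ℚ - qᵇ)) * (rᵀ * (rᵃ * rᵇ)) ≡ (x * P * rᵀ) * ((qᵃ * rᵃ) * (rᵇ - qᵇ * rᵇ))
    regroup = solve-∀ ℚ-ring

  coeff-step : ∀ j → coeff j ≡ q * q * ((coeff j + coeff (suc j)) * pow q (3 ℕ.* j))
  coeff-step j = sym (begin
    q * q * ((coeff j + coeff (suc j)) * pow q (3 ℕ.* j))        ≡⟨ cong (λ x → q * q * ((coeff j + x) * pow q (3 ℕ.* j))) (coeff-suc j) ⟩
    q * q * ((coeff j + coeff j * (rᵇ - 1ℚ)) * pow q (3 ℕ.* j))  ≡⟨ collect q (coeff j) rᵇ (pow q (3 ℕ.* j)) ⟩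
    coeff j * (pow q (3 ℕ.* j) * q * q * rᵇ)                      ≡⟨ cong (λ x → coeff j * (x * rᵇ)) (trans (unit (pow q (3 ℕ.* j)) q) (pow-+-≡ q {3 ℕ.* j} {2} refl)) ⟩
    coeff j * (pow q (3 ℕ.* j ℕ.+ 2) * rᵇ)                       ≡⟨ cong (coeff j *_) (pow-inverse qr≡1 (3 ℕ.* j ℕ.+ 2)) ⟩
    coeff j * 1ℚ                                                 ≡⟨ ℚ.*-identityʳ (coeff j) ⟩
    coeff j                                                      ∎)
    where
    rᵇ = pow r (3 ℕ.* j ℕ.+ 2)
    collect : ∀ q c R p → q * q * ((c + c * (R - 1ℚ)) * p) ≡ c * (p * q * q * R)
    collect = solve-∀ ℚ-ring
    unit : ∀ p q → p * q * q ≡ p * (1ℚ * q * q)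
    unit = solve-∀ ℚ-ring

  Λ : ℕ → (ℕ → ℚ) → ℚ
  Λ K a = ∑ K (λ j → coeff j * a (3 ℕ.* j))

  Λ-cong : ∀ K {a b : ℕ → ℚ} → (∀ i → a i ≡ b i) → Λ K a ≡ Λ K b
  Λ-cong K a≡b = ∑-cong K (λ j → cong (coeff j *_) (a≡b (3 ℕ.* j)))

  Λ-+ : ∀ K (a b : ℕ → ℚ) → Λ K (λ i → a i + b i) ≡ Λ K a + Λ K b
  Λ-+ K a b = trans (∑-cong K (λ j → ℚ.*-distribˡ-+ (coeff j) (a (3 ℕ.* j)) (b (3 ℕ.* j)))) (∑-+ K _ _)

  Λ-*ˡ : ∀ K c (a : ℕ → ℚ) → Λ K (λ i → c * a i) ≡ c * Λ K a
  Λ-*ˡ K c a = trans (∑-cong K (λ j → swap (coeff j) c (a (3 ℕ.* j)))) (∑-*ˡ K c _)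
    where
    swap : ∀ x c a → x * (c * a) ≡ c * (x * a)
    swap = solve-∀ ℚ-ring

  Λ-+-* : ∀ K (a b : ℕ → ℚ) c → Λ K (λ i → a i + c * b i) ≡ Λ K a + c * Λ K b
  Λ-+-* K a b c = trans (Λ-+ K a (λ i → c * b i)) (cong (Λ K a +_) (Λ-*ˡ K c b))

  Λ-alternating : ∀ K (a b d : ℕ → ℚ) → Λ K (λ i → a i - b i + d i) ≡ Λ K a - Λ K b + Λ K d
  Λ-alternating K a b d = begin
    Λ K (λ i → a i - b i + d i)                   ≡⟨ Λ-cong K (λ i → cong (_+ d i) (sub-as-add (a i) (b i))) ⟩
    Λ K (λ i → (a i + (- 1ℚ) * b i) + d i)        ≡⟨ Λ-+ K (λ i → a i + (- 1ℚ) * b i) d ⟩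
    Λ K (λ i → a i + (- 1ℚ) * b i) + Λ K d        ≡⟨ cong (_+ Λ K d) (Λ-+-* K a b (- 1ℚ)) ⟩
    (Λ K a + (- 1ℚ) * Λ K b) + Λ K d              ≡⟨ cong (_+ Λ K d) (sym (sub-as-add (Λ K a) (Λ K b))) ⟩
    Λ K a - Λ K b + Λ K d                         ∎
    where
    sub-as-add : ∀ x y → x - y ≡ x + (- 1ℚ) * y
    sub-as-add = solve-∀ ℚ-ring

  Λ-drop : ∀ K a → a (3 ℕ.* K) ≡ 0ℚ → Λ (suc K) a ≡ Λ K a
  Λ-drop K a aK≡0 = begin
    Λ (suc K) a                          ≡⟨ ∑-sucʳ K _ ⟩
    Λ K a + coeff K * a (3 ℕ.* K)        ≡⟨ cong (λ x → Λ K a + coeff K * x) aK≡0 ⟩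
    Λ K a + coeff K * 0ℚ                 ≡⟨ trans (cong (Λ K a +_) (ℚ.*-zeroʳ (coeff K))) (ℚ.+-identityʳ (Λ K a)) ⟩
    Λ K a                                ∎

  Λ-q-difference : ∀ K a → a (3 ℕ.* K) ≡ 0ℚ →
    Λ (suc K) a ≡ q * q * Λ (suc K) (λ i → scale q a i + shift (shift (shift (scale q a))) i)
  Λ-q-difference K a aK≡0 = begin
    Λ (suc K) a
      ≡⟨ Λ-drop K a aK≡0 ⟩
    Λ K a
      ≡⟨ ∑-cong K step ⟩
    ∑ K (λ j → q * q * (coeff j * b (3 ℕ.* j) + coeff (suc j) * b (3 ℕ.* j)))
      ≡⟨ ∑-*ˡ K (q * q) _ ⟩
    q * q * ∑ K (λ j → coeff j * b (3 ℕ.* j) + coeff (suc j) * b (3 ℕ.* j))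
      ≡⟨ cong (q * q *_) (∑-+ K _ _) ⟩
    q * q * (Λ K b + ∑ K (λ j → coeff (suc j) * b (3 ℕ.* j)))
      ≡⟨ cong₂ (λ x y → q * q * (x + y)) (sym (Λ-drop K b bK≡0)) (sym shifted) ⟩
    q * q * (Λ (suc K) b + Λ (suc K) b³)
      ≡⟨ cong (q * q *_) (sym (Λ-+ (suc K) b b³)) ⟩
    q * q * Λ (suc K) (λ i → b i + b³ i) ∎
    where
    b  = scale q a
    b³ = shift (shift (shift b))
    step : ∀ j → coeff j * a (3 ℕ.* j) ≡ q * q * (coeff j * b (3 ℕ.* j) + coeff (suc j) * b (3 ℕ.* j))
    step j = trans (cong (_* a (3 ℕ.* j)) (coeff-step j)) (distrib q (coeff j) (coeff (suc j)) (pow q (3 ℕ.* j)) (a (3 ℕ.* j)))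
      where
      distrib : ∀ q c c′ p x → q * q * ((c + c′) * p) * x ≡ q * q * (c * (p * x) + c′ * (p * x))
      distrib = solve-∀ ℚ-ring
    bK≡0 : b (3 ℕ.* K) ≡ 0ℚ
    bK≡0 = trans (cong (pow q (3 ℕ.* K) *_) aK≡0) (ℚ.*-zeroʳ (pow q (3 ℕ.* K)))
    shifted : Λ (suc K) b³ ≡ ∑ K (λ j → coeff (suc j) * b (3 ℕ.* j))
    shifted = begin
      coeff 0 * 0ℚ + ∑ K (λ j → coeff (suc j) * b³ (3 ℕ.* suc j))
        ≡⟨ cong₂ _+_ (ℚ.*-zeroʳ (coeff 0)) (∑-cong K (λ j → cong (λ i → coeff (suc j) * b³ i) (ℕ.*-suc 3 j))) ⟩
      0ℚ + ∑ K (λ j → coeff (suc j) * b (3 ℕ.* j))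
        ≡⟨ ℚ.+-identityˡ _ ⟩
      ∑ K (λ j → coeff (suc j) * b (3 ℕ.* j)) ∎

  f₀ f₁ f₂ : ℕ → ℚ
  f₀ N = Λ (2 ℕ.+ N) (pochCoeff q N)
  f₁ N = Λ (2 ℕ.+ N) (shift (pochCoeff q N))
  f₂ N = Λ (2 ℕ.+ N) (shift (shift (pochCoeff q N)))

  N+2<3[2+N] : ∀ N → 2 ℕ.+ N ℕ.< 3 ℕ.* (2 ℕ.+ N)
  N+2<3[2+N] N = subst (3 ℕ.+ N ℕ.≤_) (sym (arith N)) (ℕ.m≤m+n (3 ℕ.+ N) (2 ℕ.* N ℕ.+ 3))
    where
    arith : ∀ N → 3 ℕ.* (2 ℕ.+ N) ≡ 3 ℕ.+ N ℕ.+ (2 ℕ.* N ℕ.+ 3)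
    arith = ℕ-solve-∀

  tail₀ : ∀ N → pochCoeff q N (3 ℕ.* (2 ℕ.+ N)) ≡ 0ℚ
  tail₀ N = pochCoeff-vanish q (ℕ.<-trans (ℕ.<-trans (ℕ.n<1+n N) (ℕ.n<1+n (suc N))) (N+2<3[2+N] N))

  tail₁ : ∀ N → shift (pochCoeff q N) (3 ℕ.* (2 ℕ.+ N)) ≡ 0ℚ
  tail₁ N = shift-vanish (pochCoeff q N) (pochCoeff-vanish q) (ℕ.<-trans (ℕ.n<1+n (suc N)) (N+2<3[2+N] N))

  tail₂ : ∀ N → shift (shift (pochCoeff q N)) (3 ℕ.* (2 ℕ.+ N)) ≡ 0ℚ
  tail₂ N = shift-vanish (shift (pochCoeff q N)) (shift-vanish (pochCoeff q N) (pochCoeff-vanish q)) (N+2<3[2+N] N)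

  f₀-suc : ∀ N → f₀ (suc N) ≡ f₀ N + pow q N * f₁ N
  f₀-suc N = begin
    Λ (3 ℕ.+ N) (pochCoeff q (suc N))                                         ≡⟨ Λ-cong (3 ℕ.+ N) (pochCoeff-rec q N) ⟩
    Λ (3 ℕ.+ N) (λ i → pochCoeff q N i + pow q N * shift (pochCoeff q N) i)   ≡⟨ Λ-+-* (3 ℕ.+ N) (pochCoeff q N) (shift (pochCoeff q N)) (pow q N) ⟩
    Λ (3 ℕ.+ N) (pochCoeff q N) + pow q N * Λ (3 ℕ.+ N) (shift (pochCoeff q N))
                                                                              ≡⟨ cong₂ (λ x y → x + pow q N * y) (Λ-drop (2 ℕ.+ N) (pochCoeff q N) (tail₀ N)) (Λ-drop (2 ℕ.+ N) (shift (pochCoeff q N)) (tail₁ N)) ⟩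
    f₀ N + pow q N * f₁ N                                                     ∎

  f₁-suc : ∀ N → f₁ (suc N) ≡ f₁ N + pow q N * f₂ N
  f₁-suc N = begin
    Λ (3 ℕ.+ N) (shift (pochCoeff q (suc N)))
      ≡⟨ Λ-cong (3 ℕ.+ N) (λ i → trans (shift-cong (pochCoeff-rec q N) i) (shift-+-* (pochCoeff q N) (shift (pochCoeff q N)) (pow q N) i)) ⟩
    Λ (3 ℕ.+ N) (λ i → shift (pochCoeff q N) i + pow q N * shift (shift (pochCoeff q N)) i)
      ≡⟨ Λ-+-* (3 ℕ.+ N) (shift (pochCoeff q N)) (shift (shift (pochCoeff q N))) (pow q N) ⟩
    Λ (3 ℕ.+ N) (shift (pochCoeff q N)) + pow q N * Λ (3 ℕ.+ N) (shift (shift (pochCoeff q N)))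
      ≡⟨ cong₂ (λ x y → x + pow q N * y) (Λ-drop (2 ℕ.+ N) (shift (pochCoeff q N)) (tail₁ N)) (Λ-drop (2 ℕ.+ N) (shift (shift (pochCoeff q N))) (tail₂ N)) ⟩
    f₁ N + pow q N * f₂ N ∎

  -- (1 − x + x²)(1 + x) = 1 + x³ turns the q-difference equation of Λ into a relation between N and N + 1.
  f₀-q-difference : ∀ N → q * q * (f₀ (suc N) - f₁ (suc N) + f₂ (suc N)) ≡ f₀ N
  f₀-q-difference N = sym (begin
    Λ (2 ℕ.+ N) (pochCoeff q N)                        ≡⟨ sym (Λ-drop (2 ℕ.+ N) (pochCoeff q N) (tail₀ N)) ⟩
    Λ (3 ℕ.+ N) (pochCoeff q N)                        ≡⟨ Λ-q-difference (2 ℕ.+ N) (pochCoeff q N) (tail₀ N) ⟩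
    q * q * Λ (3 ℕ.+ N) (λ i → Z i + Z³ i)             ≡⟨ cong (q * q *_) (Λ-cong (3 ℕ.+ N) pointwise) ⟩
    q * q * Λ (3 ℕ.+ N) (λ i → Y i - shift Y i + shift (shift Y) i)
                                                       ≡⟨ cong (q * q *_) (Λ-alternating (3 ℕ.+ N) Y (shift Y) (shift (shift Y))) ⟩
    q * q * (f₀ (suc N) - f₁ (suc N) + f₂ (suc N))     ∎)
    where
    Y  = pochCoeff q (suc N)
    Z  = scale q (pochCoeff q N)
    Z³ = shift (shift (shift Z))
    Y≡ : ∀ i → Y i ≡ Z i + 1ℚ * shift Z i
    Y≡ i = trans (pochCoeff-rec′ q N i) (cong (Z i +_) (sym (ℚ.*-identityˡ (shift Z i))))
    shiftY≡ : ∀ i → shift Y i ≡ shift Z i + 1ℚ * shift (shift Z) i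
    shiftY≡ i = trans (shift-cong Y≡ i) (shift-+-* Z (shift Z) 1ℚ i)
    shift²Y≡ : ∀ i → shift (shift Y) i ≡ shift (shift Z) i + 1ℚ * Z³ i
    shift²Y≡ i = trans (shift-cong shiftY≡ i) (shift-+-* (shift Z) (shift (shift Z)) 1ℚ i)
    telescope : ∀ z z₁ z₂ z₃ → z + z₃ ≡ (z + 1ℚ * z₁) - (z₁ + 1ℚ * z₂) + (z₂ + 1ℚ * z₃)
    telescope = solve-∀ ℚ-ring
    pointwise : ∀ i → Z i + Z³ i ≡ Y i - shift Y i + shift (shift Y) i
    pointwise i = trans (telescope (Z i) (shift Z i) (shift (shift Z) i) (Z³ i))
                        (sym (cong₃ (λ x y z → x - y + z) (Y≡ i) (shiftY≡ i) (shift²Y≡ i)))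

  f₀-zero : f₀ 0 ≡ 1ℚ
  f₀-zero = Λ-drop 1 (pochCoeff q 0) (pochCoeff-vanish q {0} {3} (s≤s z≤n))

  f₁-zero : f₁ 0 ≡ 0ℚ
  f₁-zero = Λ-drop 1 (shift (pochCoeff q 0)) (pochCoeff-vanish q {0} {2} (s≤s z≤n))

  f₂-zero : f₂ 0 ≡ 0ℚ
  f₂-zero = Λ-drop 1 (shift (shift (pochCoeff q 0))) (pochCoeff-vanish q {0} {1} (s≤s z≤n))

  fN≡f₀ : NotRootOfUnity q → ∀ N → fN N q ≡ f₀ N
  fN≡f₀ q↯ N = begin
    fN N q                                  ≡⟨ sumTo≡∑ (suc N) (λ j → pow q (f-exponent j) * gbinℕ q N (3 ℕ.* j) * poch (pow q 2) (pow q 3) j) ⟩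
    ∑ (suc N) (λ j → pow q (f-exponent j) * gbinℕ q N (3 ℕ.* j) * poch (pow q 2) (pow q 3) j)
                                            ≡⟨ ∑-cong (suc N) summand ⟩
    Λ (suc N) (pochCoeff q N)               ≡⟨ sym (Λ-drop (suc N) (pochCoeff q N) (pochCoeff-vanish q (ℕ.m≤m+n (suc N) _))) ⟩
    f₀ N                                    ∎
    where
    summand : ∀ j → pow q (f-exponent j) * gbinℕ q N (3 ℕ.* j) * poch (pow q 2) (pow q 3) j ≡ coeff j * pochCoeff q N (3 ℕ.* j)
    summand j = begin
      x * gbinℕ q N (3 ℕ.* j) * P                  ≡⟨ cong (λ b → x * b * P) (gbinℕ≡qbinom q↯ N (3 ℕ.* j)) ⟩
      x * qbinom q N (3 ℕ.* j) * P                 ≡⟨ sym (ℚ.*-identityʳ _) ⟩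
      x * qbinom q N (3 ℕ.* j) * P * 1ℚ            ≡⟨ cong (x * qbinom q N (3 ℕ.* j) * P *_) (sym (pow-inverse qr≡1 (binom2 (3 ℕ.* j)))) ⟩
      x * qbinom q N (3 ℕ.* j) * P * (pow q (binom2 (3 ℕ.* j)) * pow r (binom2 (3 ℕ.* j)))
                                                   ≡⟨ regroup x (qbinom q N (3 ℕ.* j)) P (pow q (binom2 (3 ℕ.* j))) (pow r (binom2 (3 ℕ.* j))) ⟩
      coeff j * pochCoeff q N (3 ℕ.* j)            ∎
      where
      x = pow q (f-exponent j)
      P = poch (pow q 2) (pow q 3) j
      regroup : ∀ x b P t u → x * b * P * (t * u) ≡ (x * P * u) * (t * b)
      regroup = solve-∀ ℚ-ring

  Invariant : ℕ → Set
  Invariant n = f₀ (suc n) ≡ g q (suc n) - pow q n * g q n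
              × q * f₁ (suc n) ≡ (1ℚ - pow q (suc n)) * g q n
              × pow q (2 ℕ.+ n) * f₂ (suc n) ≡ (1ℚ - pow q (2 ℕ.+ n)) * g q (suc n) - (1ℚ - pow q (suc n)) * g q n

  invariant-zero : Invariant 0
  invariant-zero = f₀≡ , f₁≡ , f₂≡
    where
    f₀-one : f₀ 1 ≡ 1ℚ
    f₀-one = trans (f₀-suc 0) (cong₂ (λ x y → x + 1ℚ * y) f₀-zero f₁-zero)
    f₁-one : f₁ 1 ≡ 0ℚ
    f₁-one = trans (f₁-suc 0) (cong₂ (λ x y → x + 1ℚ * y) f₁-zero f₂-zero)
    f₀≡ : f₀ 1 ≡ g q 1 - 1ℚ * g q 0
    f₀≡ = f₀-one
    f₁≡ : q * f₁ 1 ≡ (1ℚ - pow q 1) * g q 0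
    f₁≡ = trans (cong (q *_) f₁-one) (trans (ℚ.*-zeroʳ q) (sym (ℚ.*-zeroʳ (1ℚ - pow q 1))))
    f₂≡ : pow q 2 * f₂ 1 ≡ (1ℚ - pow q 2) * g q 1 - (1ℚ - pow q 1) * g q 0
    f₂≡ = begin
      1ℚ * q * q * f₂ 1                                   ≡⟨ isolate q (f₀ 1) (f₁ 1) (f₂ 1) ⟩
      q * q * (f₀ 1 - f₁ 1 + f₂ 1) - q * q * (f₀ 1 - f₁ 1) ≡⟨ cong₂ (λ x y → x - q * q * y) (f₀-q-difference 0) (cong₂ _-_ f₀-one f₁-one) ⟩
      f₀ 0 - q * q * (1ℚ - 0ℚ)                            ≡⟨ cong (λ x → x - q * q * (1ℚ - 0ℚ)) f₀-zero ⟩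
      1ℚ - q * q * (1ℚ - 0ℚ)                              ≡⟨ evaluate q ⟩
      (1ℚ - 1ℚ * q * q) * 1ℚ - (1ℚ - 1ℚ * q) * 0ℚ         ∎
      where
      isolate : ∀ q a b c → 1ℚ * q * q * c ≡ q * q * (a - b + c) - q * q * (a - b)
      isolate = solve-∀ ℚ-ring
      evaluate : ∀ q → 1ℚ - q * q * (1ℚ - 0ℚ) ≡ (1ℚ - 1ℚ * q * q) * 1ℚ - (1ℚ - 1ℚ * q) * 0ℚ
      evaluate = solve-∀ ℚ-ring

  g-rec′ : ∀ n → g q (2 ℕ.+ n) ≡ (1ℚ + pow q n * q) * g q (suc n) - (pow q n * pow q n * q) * g q n
  g-rec′ n = trans (g-rec q n) (cong (λ x → (1ℚ + pow q n * q) * g q (suc n) - x * q * g q n) (pow-+ q n n))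

  module InvariantStep (n : ℕ) (IH : Invariant n) where

    a g₀ g₁ g₂ : ℚ
    a  = pow q n
    g₀ = g q n
    g₁ = g q (suc n)
    g₂ = g q (2 ℕ.+ n)

    IH₀ : f₀ (suc n) ≡ g₁ - a * g₀
    IH₀ = proj₁ IH
    IH₁ : q * f₁ (suc n) ≡ (1ℚ - a * q) * g₀
    IH₁ = proj₁ (proj₂ IH)
    IH₂ : a * q * q * f₂ (suc n) ≡ (1ℚ - a * q * q) * g₁ - (1ℚ - a * q) * g₀
    IH₂ = proj₂ (proj₂ IH)

    f₀-step : f₀ (2 ℕ.+ n) ≡ g₂ - a * q * g₁
    f₀-step = begin
      f₀ (2 ℕ.+ n)                                ≡⟨ f₀-suc (suc n) ⟩
      f₀ (suc n) + a * q * f₁ (suc n)             ≡⟨ cong (f₀ (suc n) +_) (ℚ.*-assoc a q (f₁ (suc n))) ⟩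
      f₀ (suc n) + a * (q * f₁ (suc n))           ≡⟨ cong₂ (λ x y → x + a * y) IH₀ IH₁ ⟩
      (g₁ - a * g₀) + a * ((1ℚ - a * q) * g₀)     ≡⟨ collect g₁ g₀ a q ⟩
      ((1ℚ + a * q) * g₁ - (a * a * q) * g₀) - a * q * g₁
                                                  ≡⟨ cong (_- a * q * g₁) (sym (g-rec′ n)) ⟩
      g₂ - a * q * g₁                             ∎
      where
      collect : ∀ g₁ g₀ a q → (g₁ - a * g₀) + a * ((1ℚ - a * q) * g₀) ≡ ((1ℚ + a * q) * g₁ - (a * a * q) * g₀) - a * q * g₁
      collect = solve-∀ ℚ-ring

    f₁-step : q * f₁ (2 ℕ.+ n) ≡ (1ℚ - a * q * q) * g₁
    f₁-step = begin
      q * f₁ (2 ℕ.+ n)                                                   ≡⟨ cong (q *_) (f₁-suc (suc n)) ⟩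
      q * (f₁ (suc n) + a * q * f₂ (suc n))                               ≡⟨ distrib q (f₁ (suc n)) a (f₂ (suc n)) ⟩
      q * f₁ (suc n) + a * q * q * f₂ (suc n)                             ≡⟨ cong₂ _+_ IH₁ IH₂ ⟩
      (1ℚ - a * q) * g₀ + ((1ℚ - a * q * q) * g₁ - (1ℚ - a * q) * g₀)     ≡⟨ cancel a q g₁ g₀ ⟩
      (1ℚ - a * q * q) * g₁                                              ∎
      where
      distrib : ∀ q u a v → q * (u + a * q * v) ≡ q * u + a * q * q * v
      distrib = solve-∀ ℚ-ring
      cancel : ∀ a q g₁ g₀ → (1ℚ - a * q) * g₀ + ((1ℚ - a * q * q) * g₁ - (1ℚ - a * q) * g₀) ≡ (1ℚ - a * q * q) * g₁
      cancel = solve-∀ ℚ-ring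

    f₂-step : a * q * q * q * f₂ (2 ℕ.+ n) ≡ (1ℚ - a * q * q * q) * g₂ - (1ℚ - a * q * q) * g₁
    f₂-step = begin
      a * q * q * q * f₂ (2 ℕ.+ n)
        ≡⟨ isolate a q (f₀ (2 ℕ.+ n)) (f₁ (2 ℕ.+ n)) (f₂ (2 ℕ.+ n)) ⟩
      a * q * (q * q * (f₀ (2 ℕ.+ n) - f₁ (2 ℕ.+ n) + f₂ (2 ℕ.+ n))) - a * q * q * q * f₀ (2 ℕ.+ n) + a * q * q * (q * f₁ (2 ℕ.+ n))
        ≡⟨ cong₃ (λ x y z → a * q * x - a * q * q * q * y + a * q * q * z) (f₀-q-difference (suc n)) f₀-step f₁-step ⟩
      a * q * f₀ (suc n) - a * q * q * q * (g₂ - a * q * g₁) + a * q * q * ((1ℚ - a * q * q) * g₁)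
        ≡⟨ cong₂ (λ x y → a * q * x - a * q * q * q * (y - a * q * g₁) + a * q * q * ((1ℚ - a * q * q) * g₁)) IH₀ (g-rec′ n) ⟩
      a * q * (g₁ - a * g₀) - a * q * q * q * (((1ℚ + a * q) * g₁ - (a * a * q) * g₀) - a * q * g₁) + a * q * q * ((1ℚ - a * q * q) * g₁)
        ≡⟨ collect a q g₁ g₀ ⟩
      (1ℚ - a * q * q * q) * ((1ℚ + a * q) * g₁ - (a * a * q) * g₀) - (1ℚ - a * q * q) * g₁
        ≡⟨ cong (λ x → (1ℚ - a * q * q * q) * x - (1ℚ - a * q * q) * g₁) (sym (g-rec′ n)) ⟩
      (1ℚ - a * q * q * q) * g₂ - (1ℚ - a * q * q) * g₁ ∎
      where
      isolate : ∀ a q f u v → a * q * q * q * v ≡ a * q * (q * q * (f - u + v)) - a * q * q * q * f + a * q * q * (q * u)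
      isolate = solve-∀ ℚ-ring
      collect : ∀ a q g₁ g₀ →
        a * q * (g₁ - a * g₀) - a * q * q * q * (((1ℚ + a * q) * g₁ - (a * a * q) * g₀) - a * q * g₁) + a * q * q * ((1ℚ - a * q * q) * g₁)
        ≡ (1ℚ - a * q * q * q) * ((1ℚ + a * q) * g₁ - (a * a * q) * g₀) - (1ℚ - a * q * q) * g₁
      collect = solve-∀ ℚ-ring

  invariant-suc : ∀ n → Invariant n → Invariant (suc n)
  invariant-suc n IH = f₀-step , f₁-step , f₂-step
    where open InvariantStep n IH

  invariant : ∀ n → Invariant n
  invariant zero    = invariant-zero
  invariant (suc n) = invariant-suc n (invariant n)

-- The case q = 0

0↯ : NotRootOfUnity 0ℚ
0↯ = notRootOfUnity (λ ()) (λ ())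

pow-0ℚ : ∀ k → pow 0ℚ (suc k) ≡ 0ℚ
pow-0ℚ k = ℚ.*-zeroʳ (pow 0ℚ k)

fN-at-0 : ∀ N → fN N 0ℚ ≡ 1ℚ
fN-at-0 N = begin
  fN N 0ℚ                 ≡⟨ sumTo≡∑ (suc N) t ⟩
  t 0 + ∑ N (t ∘ suc)     ≡⟨ cong₂ _+_ (cong (λ b → 1ℚ * b * 1ℚ) (gbinℕ≡qbinom 0↯ N 0)) (∑-zero N t-suc) ⟩
  1ℚ                      ∎
  where
  t : ℕ → ℚ
  t j = pow 0ℚ (f-exponent j) * gbinℕ 0ℚ N (3 ℕ.* j) * poch (pow 0ℚ 2) (pow 0ℚ 3) j
  t-suc : ∀ j → t (suc j) ≡ 0ℚ
  t-suc j = begin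
    t (suc j)                         ≡⟨ cong (λ e → pow 0ℚ e * b * P) exponent ⟩
    pow 0ℚ (suc (f-exponent j ℕ.+ 6 ℕ.* j)) * b * P
                                      ≡⟨ cong (λ x → x * b * P) (pow-0ℚ (f-exponent j ℕ.+ 6 ℕ.* j)) ⟩
    0ℚ * b * P                        ≡⟨ trans (cong (_* P) (ℚ.*-zeroˡ b)) (ℚ.*-zeroˡ P) ⟩
    0ℚ                                ∎
    where
    b = gbinℕ 0ℚ N (3 ℕ.* suc j)
    P = poch (pow 0ℚ 2) (pow 0ℚ 3) (suc j)
    exponent : f-exponent (suc j) ≡ suc (f-exponent j ℕ.+ 6 ℕ.* j)
    exponent = trans (f-exponent-suc j) (trans (cong (f-exponent j ℕ.+_) (ℕ.+-comm (6 ℕ.* j) 1)) (ℕ.+-suc _ _))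

g-at-0 : ∀ N → g 0ℚ (suc N) ≡ 1ℚ
g-at-0 zero    = refl
g-at-0 (suc N) = begin
  g 0ℚ (2 ℕ.+ N)                                                      ≡⟨ g-rec 0ℚ N ⟩
  (1ℚ + pow 0ℚ (suc N)) * g 0ℚ (suc N) - pow 0ℚ (suc (N ℕ.+ N)) * g 0ℚ N
                                                                      ≡⟨ cong₃ (λ x y z → (1ℚ + x) * y - z * g 0ℚ N) (pow-0ℚ N) (g-at-0 N) (pow-0ℚ (N ℕ.+ N)) ⟩
  (1ℚ + 0ℚ) * 1ℚ - 0ℚ * g 0ℚ N                                        ≡⟨ evaluate (g 0ℚ N) ⟩
  1ℚ                                                                  ∎
  where
  evaluate : ∀ x → (1ℚ + 0ℚ) * 1ℚ - 0ℚ * x ≡ 1ℚ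
  evaluate = solve-∀ ℚ-ring

g-difference-at-0 : ∀ N → g 0ℚ (suc N) - pow 0ℚ N * g 0ℚ N ≡ 1ℚ
g-difference-at-0 zero    = refl
g-difference-at-0 (suc N) = begin
  g 0ℚ (2 ℕ.+ N) - pow 0ℚ (suc N) * g 0ℚ (suc N)   ≡⟨ cong₂ (λ x y → x - y * g 0ℚ (suc N)) (g-at-0 (suc N)) (pow-0ℚ N) ⟩
  1ℚ - 0ℚ * g 0ℚ (suc N)                           ≡⟨ evaluate (g 0ℚ (suc N)) ⟩
  1ℚ                                               ∎
  where
  evaluate : ∀ x → 1ℚ - 0ℚ * x ≡ 1ℚ
  evaluate = solve-∀ ℚ-ring


-- The f side uses r = q⁻¹, so q = 0 is checked directly.
fN≡g-difference : ∀ N {q} → NotRootOfUnity q → fN (suc N) q ≡ g q (suc N) - pow q N * g q N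
fN≡g-difference N {q} q↯ with q ℚ.≟ 0ℚ
... | yes refl = trans (fN-at-0 (suc N)) (sym (g-difference-at-0 N))
... | no  q≢0  = trans (fN≡f₀ q*q⁻¹≡1 q↯ (suc N)) (proj₁ (invariant q*q⁻¹≡1 N))
  where
  instance
    q-nonZero : ℚ.NonZero q
    q-nonZero = ≢-nonZero q≢0
  q*q⁻¹≡1 : q * 1/ q ≡ 1ℚ
  q*q⁻¹≡1 = ℚ.*-inverseʳ q

open import Data.Integer using (+_)

theorem4p1 : ∀ (N : ℕ) (q : ℚ) → q ≢ 1ℚ → q ≢ - 1ℚ →
    fN (suc N) q ≡ F011 (+ N) q 1ℚ - pow q N * F011 (+ N ℤ.- + 1) q 1ℚ
theorem4p1 N q q≢1 q≢-1 = begin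
  fN (suc N) q                                            ≡⟨ fN≡g-difference N q↯ ⟩
  g q (suc N) - pow q N * g q N                           ≡⟨ sym (cong₂ (λ x y → x - pow q N * y) (F011≡g q↯ N) (F011-pred≡g q↯ N)) ⟩
  F011 (+ N) q 1ℚ - pow q N * F011 (+ N ℤ.- + 1) q 1ℚ     ∎
  where
  q↯ : NotRootOfUnity q
  q↯ = notRootOfUnity q≢1 q≢-1
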